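{- The model-checking problem for $\mathrm{GHyLTL}_{S+C}$ (given a finite transition system $\mathcal{T}$ and a $\mathrm{GHyLTL}_{S+C}$ sentence $\varphi$, decide whether $\mathrm{Tr}(\mathcal{T})\models\varphi$) is reducible to truth in second-order arithmetic.
   Context: A transition system is $\mathcal{T}=(V,E,I,\ell)$ with finite nonempty $V$, $E\subseteq V\times V$ such that every vertex has an outgoing edge, $I\subseteq V$ initial vertices, and $\ell:V\to2^{\mathrm{AP}}$. A run is $v_0v_1\cdots$ with $v_0\in I$, $(v_i,v_{i+1})\in E$; $\mathrm{Tr}(\mathcal{T})=\{\ell(v_0)\ell(v_1)\cdots\mid v_0v_1\cdots\text{ a run}\}$. A trace is $\sigma\in(2^{\mathrm{AP}})^\omega$; a pointed trace is $(\sigma,i)$, $i\in\mathbb{N}$. PLTL: $\theta::=p\mid\neg\theta\mid\theta\vee\theta\mid\mathbf{X}\theta\mid\theta\,\mathbf{U}\,\theta\mid\mathbf{Y}\theta\mid\theta\,\mathbf{S}\,\theta$ with standard semantics ($\mathbf{Y}$ false at position 0). Stuttering: for finite $\Gamma\subseteq$ PLTL and trace $\sigma$, $i$ is a proper $\Gamma$-changepoint if $i=0$ or some $\theta\in\Gamma$ changes truth value between $i-1$ and $i$; if finitely many, the largest being $i$, all positions $>i$ are also $\Gamma$-changepoints. $\mathrm{succ}_\Gamma(\sigma,i)$ moves to the least $\Gamma$-changepoint $>i$; $\mathrm{pred}_\Gamma(\sigma,i)$ for $i>0$ to the largest $\Gamma$-changepoint $<i$ (undefined at 0). $\mathrm{GHyLTL}_{S+C}$: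 $\varphi::=p_x\mid\neg\varphi\mid\varphi\vee\varphi\mid\langle C\rangle\varphi\mid\mathbf{X}_\Gamma\varphi\mid\varphi\,\mathbf{U}_\Gamma\,\varphi\mid\mathbf{Y}_\Gamma\varphi\mid\varphi\,\mathbf{S}_\Gamma\,\varphi\mid\exists x.\varphi\mid\forall x.\varphi$ (contexts $C$ nonempty sets of trace variables, $\Gamma$ finite sets of PLTL formulas). Semantics w.r.t. a set $\mathcal{L}$ of traces, an assignment $\Pi$ of trace variables to pointed traces, and a context $C$: $p_x$ iff $\Pi(x)=(\sigma,i)$, $p\in\sigma(i)$; $\langle C'\rangle$ switches context; $\mathbf{X}_\Gamma,\mathbf{U}_\Gamma$ evaluate along iterates of $\mathrm{succ}_{(\Gamma,C)}$, which applies $\mathrm{succ}_\Gamma$ to variables in $C$ only; $\mathbf{Y}_\Gamma,\mathbf{S}_\Gamma$ analogously along $\mathrm{pred}_{(\Gamma,C)}$, which must be defined (defined iff $\mathrm{pred}_\Gamma$ is defined for all $x\in C$); $\exists x$/$\forall x$ range over $\sigma\in\mathcal{L}$ binding $x$ to $(\sigma,0)$, also under temporal operators. $\mathcal{L}\models\varphi$ for a sentence: empty assignment, context = all variables. Truth in second-order arithmetic: given a sentence of second-order arithmetic (first-order quantification over $\mathbb{N}$, second-order over subsets of $\mathbb{N}$, signature $(+,\cdot,<,\in)$), decide whether it holds in $(\mathbb{N},+,\cdot,<,\in)$. Reducibility means a computable many-one reduction. -}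

module Defs where

open import Level using (0ℓ)
open import Data.Nat using (ℕ; zero; suc; _<_; _≤_; _≡ᵇ_)
open import Data.Bool using (Bool; true; false; if_then_else_)
open import Data.Fin using (Fin)
open import Data.List using (List)
open import Data.Bool.ListAction using (any)
open import Data.List.NonEmpty using (List⁺; toList)
open import Data.List.Membership.Propositional using (_∈_)
open import Data.Maybe using (Maybe; just; nothing)
open import Data.Product using (Σ; ∃; _×_; _,_)
open import Data.Sum using (_⊎_)
open import Data.Empty using (⊥)
open import Relation.Nullary using (¬_)
open import Relation.Binary.PropositionalEquality using (_≡_)
open import Function.Bundles using (_⇔_)
open import Axiom.ExcludedMiddle using (ExcludedMiddle)

-- Atomic propositions are natural numbers; a letter of
-- 2^AP occurring in a trace is given by a finite list of propositions
-- (traces of finite transition systems only use finitely many letters).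

Letter : Set
Letter = List ℕ

Trace : Set
Trace = ℕ → Letter

record TS : Set where
  field
    size     : ℕ
    nonempty : 1 ≤ size
    edge     : Fin size → Fin size → Bool
    total    : ∀ v → ∃ λ w → edge v w ≡ true
    init     : Fin size → Bool
    label    : Fin size → Letter

open TS public

IsRun : (T : TS) → (ℕ → Fin (size T)) → Set
IsRun T ρ = (init T (ρ 0) ≡ true) × (∀ i → edge T (ρ i) (ρ (suc i)) ≡ true)

Tr : TS → Trace → Set
Tr T σ = Σ (ℕ → Fin (size T)) λ ρ → IsRun T ρ × (∀ i → σ i ≡ label T (ρ i))

data PLTL : Set where
  atom : ℕ → PLTL
  ¬ₚ_  : PLTL → PLTL
  _∨ₚ_ : PLTL → PLTL → PLTL
  Xₚ   : PLTL → PLTL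
  _Uₚ_ : PLTL → PLTL → PLTL
  Yₚ   : PLTL → PLTL
  _Sₚ_ : PLTL → PLTL → PLTL

_,_⊨ₚ_ : Trace → ℕ → PLTL → Set
σ , i ⊨ₚ atom p = p ∈ σ i
σ , i ⊨ₚ (¬ₚ θ) = ¬ (σ , i ⊨ₚ θ)
σ , i ⊨ₚ (θ ∨ₚ θ') = (σ , i ⊨ₚ θ) ⊎ (σ , i ⊨ₚ θ')
σ , i ⊨ₚ Xₚ θ = σ , suc i ⊨ₚ θ
σ , i ⊨ₚ (θ Uₚ θ') =
  Σ ℕ λ k → (i ≤ k) × (σ , k ⊨ₚ θ') × (∀ j → i ≤ j → j < k → σ , j ⊨ₚ θ)
σ , zero  ⊨ₚ Yₚ θ = ⊥
σ , suc i ⊨ₚ Yₚ θ = σ , i ⊨ₚ θ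
σ , i ⊨ₚ (θ Sₚ θ') =
  Σ ℕ λ k → (k ≤ i) × (σ , k ⊨ₚ θ') × (∀ j → k < j → j ≤ i → σ , j ⊨ₚ θ)

ChangesAt : Trace → ℕ → PLTL → Set
ChangesAt σ j θ =
  ((σ , j ⊨ₚ θ) × ¬ (σ , suc j ⊨ₚ θ)) ⊎ (¬ (σ , j ⊨ₚ θ) × (σ , suc j ⊨ₚ θ))

ProperCP : List PLTL → Trace → ℕ → Set
ProperCP Γ σ i =
  (i ≡ 0) ⊎ (Σ ℕ λ j → (i ≡ suc j) × (Σ PLTL λ θ → (θ ∈ Γ) × ChangesAt σ j θ))

CP : List PLTL → Trace → ℕ → Set
CP Γ σ i =
  ProperCP Γ σ i ⊎
  (Σ ℕ λ m → ProperCP Γ σ m × (∀ k → ProperCP Γ σ k → k ≤ m) × (m < i))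

IsSucc : List PLTL → Trace → ℕ → ℕ → Set
IsSucc Γ σ i j = (i < j) × CP Γ σ j × (∀ k → i < k → k < j → ¬ CP Γ σ k)

IsPred : List PLTL → Trace → ℕ → ℕ → Set
IsPred Γ σ i j = (j < i) × CP Γ σ j × (∀ k → j < k → k < i → ¬ CP Γ σ k)

-- GHyLTL_{S+C}.  Trace variables are natural numbers; contexts are
-- nonempty finite sets (lists) of trace variables.

Var : Set
Var = ℕ

data GHy : Set where
  ap    : ℕ → Var → GHy
  ¬ₕ_   : GHy → GHy
  _∨ₕ_  : GHy → GHy → GHy
  ⟨_⟩_  : List⁺ Var → GHy → GHy
  Xₕ    : List PLTL → GHy → GHy
  Uₕ    : List PLTL → GHy → GHy → GHy        -- Uₕ Γ φ ψ = φ U_Γ ψ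
  Yₕ    : List PLTL → GHy → GHy
  Sₕ    : List PLTL → GHy → GHy → GHy        -- Sₕ Γ φ ψ = φ S_Γ ψ
  ∃ₕ    : Var → GHy → GHy
  ∀ₕ    : Var → GHy → GHy

ClosedGHy : List Var → GHy → Set
ClosedGHy b (ap p x) = x ∈ b
ClosedGHy b (¬ₕ φ) = ClosedGHy b φ
ClosedGHy b (φ ∨ₕ ψ) = ClosedGHy b φ × ClosedGHy b ψ
ClosedGHy b (⟨ C ⟩ φ) = ClosedGHy b φ
ClosedGHy b (Xₕ Γ φ) = ClosedGHy b φ
ClosedGHy b (Uₕ Γ φ ψ) = ClosedGHy b φ × ClosedGHy b ψ
ClosedGHy b (Yₕ Γ φ) = ClosedGHy b φ
ClosedGHy b (Sₕ Γ φ ψ) = ClosedGHy b φ × ClosedGHy b ψ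
ClosedGHy b (∃ₕ x φ) = ClosedGHy (x Data.List.∷ b) φ
ClosedGHy b (∀ₕ x φ) = ClosedGHy (x Data.List.∷ b) φ

Sentence : Set
Sentence = Σ GHy (ClosedGHy Data.List.[])

Assign : Set
Assign = Var → Maybe (Trace × ℕ)

emptyAssign : Assign
emptyAssign _ = nothing

_[_↦_] : Assign → Var → Trace × ℕ → Assign
(Π [ x ↦ a ]) y = if y ≡ᵇ x then just a else Π y

Ctx : Set
Ctx = Var → Bool

allVars : Ctx
allVars _ = true

ctxOf : List⁺ Var → Ctx
ctxOf C y = any (y ≡ᵇ_) (toList C)

MoveSucc : List PLTL → Bool → Maybe (Trace × ℕ) → Maybe (Trace × ℕ) → Set
MoveSucc Γ true  nothing        m' = m' ≡ nothing
MoveSucc Γ true  (just (σ , i)) m' = Σ ℕ λ j → IsSucc Γ σ i j × (m' ≡ just (σ , j))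
MoveSucc Γ false m              m' = m' ≡ m

MovePred : List PLTL → Bool → Maybe (Trace × ℕ) → Maybe (Trace × ℕ) → Set
MovePred Γ true  nothing        m' = m' ≡ nothing
MovePred Γ true  (just (σ , i)) m' = Σ ℕ λ j → IsPred Γ σ i j × (m' ≡ just (σ , j))
MovePred Γ false m              m' = m' ≡ m

SuccStep : List PLTL → Ctx → Assign → Assign → Set
SuccStep Γ c Π Π' = ∀ x → MoveSucc Γ (c x) (Π x) (Π' x)

-- Π' = pred_(Γ,C)(Π)  (only satisfiable when pred_(Γ,C)(Π) is defined)
PredStep : List PLTL → Ctx → Assign → Assign → Set
PredStep Γ c Π Π' = ∀ x → MovePred Γ (c x) (Π x) (Π' x)

AtomSat : ℕ → Maybe (Trace × ℕ) → Set
AtomSat p nothing        = ⊥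
AtomSat p (just (σ , i)) = p ∈ σ i

Sat : (Trace → Set) → Assign → Ctx → GHy → Set
Sat L Π c (ap p x) = AtomSat p (Π x)
Sat L Π c (¬ₕ φ) = ¬ Sat L Π c φ
Sat L Π c (φ ∨ₕ ψ) = Sat L Π c φ ⊎ Sat L Π c ψ
Sat L Π c (⟨ C ⟩ φ) = Sat L Π (ctxOf C) φ
Sat L Π c (Xₕ Γ φ) = Σ Assign λ Π' → SuccStep Γ c Π Π' × Sat L Π' c φ
Sat L Π c (Uₕ Γ φ ψ) =
  Σ ℕ λ k → Σ (ℕ → Assign) λ seq →
    (∀ x → seq 0 x ≡ Π x) ×
    (∀ j → j < k → SuccStep Γ c (seq j) (seq (suc j))) ×
    Sat L (seq k) c ψ ×
    (∀ j → j < k → Sat L (seq j) c φ)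
Sat L Π c (Yₕ Γ φ) = Σ Assign λ Π' → PredStep Γ c Π Π' × Sat L Π' c φ
Sat L Π c (Sₕ Γ φ ψ) =
  Σ ℕ λ k → Σ (ℕ → Assign) λ seq →
    (∀ x → seq 0 x ≡ Π x) ×
    (∀ j → j < k → PredStep Γ c (seq j) (seq (suc j))) ×
    Sat L (seq k) c ψ ×
    (∀ j → j < k → Sat L (seq j) c φ)
Sat L Π c (∃ₕ x φ) = Σ Trace λ σ → L σ × Sat L (Π [ x ↦ (σ , 0) ]) c φ
Sat L Π c (∀ₕ x φ) = (σ : Trace) → L σ → Sat L (Π [ x ↦ (σ , 0) ]) c φ

_⊨_ : (Trace → Set) → Sentence → Set
L ⊨ (φ , _) = Sat L emptyAssign allVars φ

MCInstance : Set
MCInstance = TS × Sentence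

ModelCheck : MCInstance → Set
ModelCheck (T , φ) = Tr T ⊨ φ

data Term : Set where
  var  : ℕ → Term
  _⊕_  : Term → Term → Term
  _⊗_  : Term → Term → Term

data SOA : Set where
  _<ₐ_  : Term → Term → SOA
  _≐_   : Term → Term → SOA
  _∈ₐ_  : Term → ℕ → SOA
  ¬ₐ_   : SOA → SOA
  _∨ₐ_  : SOA → SOA → SOA
  ∃₁    : ℕ → SOA → SOA
  ∀₁    : ℕ → SOA → SOA
  ∃₂    : ℕ → SOA → SOA
  ∀₂    : ℕ → SOA → SOA

FreeInTerm : List ℕ → Term → Set
FreeInTerm b (var n) = n ∈ b
FreeInTerm b (s ⊕ t) = FreeInTerm b s × FreeInTerm b t
FreeInTerm b (s ⊗ t) = FreeInTerm b s × FreeInTerm b t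

ClosedSOA : List ℕ → List ℕ → SOA → Set
ClosedSOA b1 b2 (s <ₐ t) = FreeInTerm b1 s × FreeInTerm b1 t
ClosedSOA b1 b2 (s ≐ t) = FreeInTerm b1 s × FreeInTerm b1 t
ClosedSOA b1 b2 (t ∈ₐ X) = FreeInTerm b1 t × (X ∈ b2)
ClosedSOA b1 b2 (¬ₐ φ) = ClosedSOA b1 b2 φ
ClosedSOA b1 b2 (φ ∨ₐ ψ) = ClosedSOA b1 b2 φ × ClosedSOA b1 b2 ψ
ClosedSOA b1 b2 (∃₁ n φ) = ClosedSOA (n Data.List.∷ b1) b2 φ
ClosedSOA b1 b2 (∀₁ n φ) = ClosedSOA (n Data.List.∷ b1) b2 φ
ClosedSOA b1 b2 (∃₂ n φ) = ClosedSOA b1 (n Data.List.∷ b2) φ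
ClosedSOA b1 b2 (∀₂ n φ) = ClosedSOA b1 (n Data.List.∷ b2) φ

IsSOASentence : SOA → Set
IsSOASentence = ClosedSOA Data.List.[] Data.List.[]

Subset : Set
Subset = ℕ → Bool

evalT : (ℕ → ℕ) → Term → ℕ
evalT e (var n) = e n
evalT e (s ⊕ t) = evalT e s Data.Nat.+ evalT e t
evalT e (s ⊗ t) = evalT e s Data.Nat.* evalT e t

upd : {A : Set} → (ℕ → A) → ℕ → A → ℕ → A
upd e n a m = if m ≡ᵇ n then a else e m

SatSOA : (ℕ → ℕ) → (ℕ → Subset) → SOA → Set
SatSOA e E (s <ₐ t) = evalT e s < evalT e t
SatSOA e E (s ≐ t) = evalT e s ≡ evalT e t
SatSOA e E (t ∈ₐ X) = E X (evalT e t) ≡ true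
SatSOA e E (¬ₐ φ) = ¬ SatSOA e E φ
SatSOA e E (φ ∨ₐ ψ) = SatSOA e E φ ⊎ SatSOA e E ψ
SatSOA e E (∃₁ n φ) = Σ ℕ λ a → SatSOA (upd e n a) E φ
SatSOA e E (∀₁ n φ) = (a : ℕ) → SatSOA (upd e n a) E φ
SatSOA e E (∃₂ n φ) = Σ Subset λ A → SatSOA e (upd E n A) φ
SatSOA e E (∀₂ n φ) = (A : Subset) → SatSOA e (upd E n A) φ

-- truth in (ℕ, +, ·, <, ∈) of a sentence (environment irrelevant)
TrueSOA : SOA → Set
TrueSOA φ = SatSOA (λ _ → 0) (λ _ _ → false) φ

-- The map f is an Agda function on finite data, hence computable; the
-- correctness of the reduction is asserted in classical mathematics
-- (under excluded middle), in which the semantics above is meant.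

ReducibleToSOATruth : Set₁
ReducibleToSOATruth =
  Σ (MCInstance → SOA) λ f →
    (∀ inst → IsSOASentence (f inst)) ×
    (ExcludedMiddle 0ℓ → ∀ inst → ModelCheck inst ⇔ TrueSOA (f inst))

{-# OPTIONS --safe #-}
-- A trace variable x bound to a run ρ of T is represented by the sets {i | ρ i = v}, one
-- for each vertex v, constrained by a first-order formula to describe a run, and its
-- current position by a first-order variable.  Over these sets, PLTL formulas,
-- Γ-changepoints, and hence succ_Γ and pred_Γ, are first-order definable.  A stuttering
-- modality with context C is encoded by guessing the number k of steps and, for every
-- x ∈ C, the set of pairs (j , position of x after j steps), which is checked step by step
-- against succ_Γ or pred_Γ; subformulas at step j are evaluated at the positions recorded
-- for j.  Trace quantifiers become second-order quantifiers over the vertex sets.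
module Submission where

open import Level using (0ℓ)
open import Axiom.ExcludedMiddle using (ExcludedMiddle)
open import Data.Nat using (ℕ; zero; suc; _+_; _*_; _<_; _≤_; _⊔_; z≤n; s≤s; _<?_; _≤?_)
open import Data.Nat.Properties
open import Data.Bool using (Bool; true; false; if_then_else_)
open import Data.Bool.Properties using (¬-not) renaming (_≟_ to _≟ᵇ_)
open import Data.Product using (Σ; ∃; _×_; _,_; proj₁; proj₂; curry; uncurry)
open import Data.Sum using (_⊎_; inj₁; inj₂)
open import Data.Empty using (⊥-elim)
open import Data.Unit using (⊤; tt)
open import Data.Maybe using (Maybe; just; nothing)
open import Data.List using (List; []; _∷_; map; allFin; filter; upTo)
open import Data.List.Relation.Unary.Any using (here; there)
open import Data.List.Membership.Propositional using (_∈_)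
open import Data.List.Membership.Propositional.Properties
  using (∈-allFin; ∈-map⁻; ∈-filter⁺; ∈-filter⁻; ∈-upTo⁺)
open import Data.List.Membership.DecPropositional _≟_ using (_∈?_)
open import Data.Fin using (Fin; toℕ)
open import Data.Fin.Properties using (toℕ-injective) renaming (_≟_ to _≟ᶠ_)
open import Relation.Nullary using (¬_; Dec; yes; no; does; ¬?)
open import Relation.Nullary.Decidable using (dec-true; dec-false; decidable-stable; from-yes)
open import Relation.Binary.PropositionalEquality
open import Relation.Binary.Definitions using (tri<; tri≈; tri>)
open import Function.Bundles using (_⇔_; mk⇔; Equivalence)
open import Function.Properties.Equivalence using ()
  renaming (refl to ⇔-refl; sym to ⇔-sym; trans to ⇔-trans)
open import Function.Related.TypeIsomorphisms using (¬-cong-⇔; →-cong-⇔)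
open import Data.Product.Function.NonDependent.Propositional using (_×-⇔_)
open import Data.Sum.Function.Propositional using (_⊎-⇔_)
open import Defs

open Equivalence using (to; from)

Σ-cong-⇔ : {A : Set} {B C : A → Set} → (∀ a → B a ⇔ C a) → Σ A B ⇔ Σ A C
Σ-cong-⇔ f = mk⇔ (λ (a , b) → a , to (f a) b) (λ (a , c) → a , from (f a) c)

Π-cong-⇔ : {A : Set} {B C : A → Set} → (∀ a → B a ⇔ C a) → ((a : A) → B a) ⇔ ((a : A) → C a)
Π-cong-⇔ f = mk⇔ (λ h a → to (f a) (h a)) (λ h a → from (f a) (h a))

×-dep-⇔ : {A A' B B' : Set} → A ⇔ A' → (A' → B ⇔ B') → (A × B) ⇔ (A' × B')
×-dep-⇔ f g = mk⇔ (λ (a , b) → to f a , to (g (to f a)) b) (λ (a' , b') → from f a' , from (g a') b')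

does-true⇒ : {P : Set} (d : Dec P) → does d ≡ true → P
does-true⇒ (yes p) _ = p

pair : ℕ → ℕ → ℕ
pair a b = (a + b) * (a + b) + a

-- With a ≤ s, the value s * s + a determines s, because s * s + s < suc s * suc s.
private
  square-plus-bound : ∀ s a → a ≤ s → s * s + a < suc s * suc s
  square-plus-bound s a a≤s = s≤s (begin
      s * s + a       ≤⟨ +-monoʳ-≤ (s * s) a≤s ⟩
      s * s + s       ≡⟨ +-comm (s * s) s ⟩
      s + s * s       ≤⟨ m≤n+m (s + s * s) s ⟩
      s + (s + s * s) ≡⟨ cong (s +_) (sym (*-suc s s)) ⟩
      s + s * suc s   ∎)
    where open ≤-Reasoning

  square-plus-mono : ∀ {s s'} a a' → a ≤ s → s < s' → s * s + a < s' * s' + a'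
  square-plus-mono {s} {s'} a a' a≤s s<s' = begin-strict
      s * s + a     <⟨ square-plus-bound s a a≤s ⟩
      suc s * suc s ≤⟨ *-mono-≤ s<s' s<s' ⟩
      s' * s'       ≤⟨ m≤m+n (s' * s') a' ⟩
      s' * s' + a'  ∎
    where open ≤-Reasoning

pair-injective : ∀ a b a' b' → pair a b ≡ pair a' b' → a ≡ a' × b ≡ b'
pair-injective a b a' b' eq with <-cmp (a + b) (a' + b')
... | tri< lt _ _ = ⊥-elim (<-irrefl eq (square-plus-mono a a' (m≤m+n a b) lt))
... | tri> _ _ gt = ⊥-elim (<-irrefl (sym eq) (square-plus-mono a' a (m≤m+n a' b') gt))
... | tri≈ _ s≡s' _ = a≡a' , +-cancelˡ-≡ a b b' (trans s≡s' (cong (_+ b') (sym a≡a')))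
  where
    a≡a' : a ≡ a'
    a≡a' = +-cancelˡ-≡ ((a + b) * (a + b)) a a' (trans eq (cong (λ s → s * s + a') (sym s≡s')))

-- First-order: posVar x holds the current
-- position of the trace variable x; the tmpVar n are auxiliary.  Second-order:
-- stateVar x v is the set of positions at which the run of x is in vertex v;
-- stepVar x is the set of pairs (j , position of x after j stuttering steps).
posVar : Var → ℕ
posVar x = pair 0 x

tmpVar : ℕ → ℕ
tmpVar n = pair 1 n

stateVar : Var → {k : ℕ} → Fin k → ℕ
stateVar x v = pair 0 (pair x (toℕ v))

stepVar : Var → ℕ
stepVar x = pair 1 x

posVar-injective : ∀ {x y} → posVar x ≡ posVar y → x ≡ y
posVar-injective {x} {y} eq = proj₂ (pair-injective 0 x 0 y eq)

tmpVar-injective : ∀ {m n} → tmpVar m ≡ tmpVar n → m ≡ n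
tmpVar-injective {m} {n} eq = proj₂ (pair-injective 1 m 1 n eq)

posVar≢tmpVar : ∀ {x n} → posVar x ≢ tmpVar n
posVar≢tmpVar {x} {n} eq with () ← proj₁ (pair-injective 0 x 1 n eq)

stepVar-injective : ∀ {x y} → stepVar x ≡ stepVar y → x ≡ y
stepVar-injective {x} {y} eq = proj₂ (pair-injective 1 x 1 y eq)

stateVar≢stepVar : ∀ {k x y} {v : Fin k} → stateVar x v ≢ stepVar y
stateVar≢stepVar {x = x} {y} {v} eq with () ← proj₁ (pair-injective 0 (pair x (toℕ v)) 1 y eq)

stateVar-injective : ∀ {k x y} {v w : Fin k} → stateVar x v ≡ stateVar y w → x ≡ y × v ≡ w
stateVar-injective {x = x} {y} {v} {w} eq
  with x≡y , v≡w ← pair-injective x (toℕ v) y (toℕ w) (proj₂ (pair-injective 0 _ 0 _ eq)) =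
  x≡y , toℕ-injective v≡w

upd-same : {A : Set} (e : ℕ → A) (n : ℕ) (a : A) → upd e n a n ≡ a
upd-same e n a rewrite dec-true (n ≟ n) refl = refl

upd-other : {A : Set} (e : ℕ → A) {n m : ℕ} (a : A) → m ≢ n → upd e n a m ≡ e m
upd-other e {n} {m} a m≢n rewrite dec-false (m ≟ n) m≢n = refl

tmpVar-<-≢ : ∀ {i n} → i < n → tmpVar i ≢ tmpVar n
tmpVar-<-≢ i<n eq = <-irrefl (tmpVar-injective eq) i<n

upd-tmpVar-< : (e : ℕ → ℕ) {i n a : ℕ} (b : ℕ) → i < n → e (tmpVar i) ≡ a → upd e (tmpVar n) b (tmpVar i) ≡ a
upd-tmpVar-< e b i<n ea = trans (upd-other e b (tmpVar-<-≢ i<n)) ea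

upd-cong : {A : Set} {e e' : ℕ → A} → (∀ m → e m ≡ e' m) → ∀ n a m → upd e n a m ≡ upd e' n a m
upd-cong {e = e} {e'} e≗e' n a m with does (m ≟ n)
... | true = refl
... | false = e≗e' m

evalT-cong : ∀ {e e'} → (∀ m → e m ≡ e' m) → ∀ t → evalT e t ≡ evalT e' t
evalT-cong e≗e' (var n) = e≗e' n
evalT-cong e≗e' (s ⊕ t) = cong₂ _+_ (evalT-cong e≗e' s) (evalT-cong e≗e' t)
evalT-cong e≗e' (s ⊗ t) = cong₂ _*_ (evalT-cong e≗e' s) (evalT-cong e≗e' t)

SatSOA-cong : ∀ {e e' E E'} → (∀ m → e m ≡ e' m) → (∀ X → E X ≡ E' X) → ∀ φ → SatSOA e E φ ⇔ SatSOA e' E' φ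
SatSOA-cong e≗e' E≗E' (s <ₐ t) =
  mk⇔ (subst₂ _<_ (evalT-cong e≗e' s) (evalT-cong e≗e' t)) (subst₂ _<_ (sym (evalT-cong e≗e' s)) (sym (evalT-cong e≗e' t)))
SatSOA-cong e≗e' E≗E' (s ≐ t) =
  mk⇔ (subst₂ _≡_ (evalT-cong e≗e' s) (evalT-cong e≗e' t)) (subst₂ _≡_ (sym (evalT-cong e≗e' s)) (sym (evalT-cong e≗e' t)))
SatSOA-cong e≗e' E≗E' (t ∈ₐ X) =
  mk⇔ (subst (_≡ true) (cong₂ (λ A i → A i) (E≗E' X) (evalT-cong e≗e' t)))
      (subst (_≡ true) (sym (cong₂ (λ A i → A i) (E≗E' X) (evalT-cong e≗e' t))))
SatSOA-cong e≗e' E≗E' (¬ₐ φ) = ¬-cong-⇔ (SatSOA-cong e≗e' E≗E' φ)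
SatSOA-cong e≗e' E≗E' (φ ∨ₐ ψ) = SatSOA-cong e≗e' E≗E' φ ⊎-⇔ SatSOA-cong e≗e' E≗E' ψ
SatSOA-cong e≗e' E≗E' (∃₁ n φ) = Σ-cong-⇔ λ a → SatSOA-cong (upd-cong e≗e' n a) E≗E' φ
SatSOA-cong e≗e' E≗E' (∀₁ n φ) = Π-cong-⇔ λ a → SatSOA-cong (upd-cong e≗e' n a) E≗E' φ
SatSOA-cong e≗e' E≗E' (∃₂ n φ) = Σ-cong-⇔ λ A → SatSOA-cong e≗e' (upd-cong E≗E' n A) φ
SatSOA-cong e≗e' E≗E' (∀₂ n φ) = Π-cong-⇔ λ A → SatSOA-cong e≗e' (upd-cong E≗E' n A) φ

-- ⊥ₐ has the free variable 0, one reason why the reduction takes a universal closure.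
⊥ₐ : SOA
⊥ₐ = var 0 <ₐ var 0

⊤ₐ : SOA
⊤ₐ = ¬ₐ ⊥ₐ

infixr 6 _∧ₐ_
infixr 5 _⇒ₐ_
infix 7 _≤ᵥ_ _<ᵥ_

_∧ₐ_ : SOA → SOA → SOA
A ∧ₐ B = ¬ₐ ((¬ₐ A) ∨ₐ (¬ₐ B))

_⇒ₐ_ : SOA → SOA → SOA
A ⇒ₐ B = (¬ₐ A) ∨ₐ B

_≤ᵥ_ : ℕ → ℕ → SOA
a ≤ᵥ b = ¬ₐ (var b <ₐ var a)

_<ᵥ_ : ℕ → ℕ → SOA
a <ᵥ b = var a <ₐ var b

isZero : ℕ → SOA
isZero a = var a ≐ (var a ⊕ var a)

isSuc : (a b t : ℕ) → SOA
isSuc a b t = a <ᵥ b ∧ₐ ¬ₐ ∃₁ t (a <ᵥ t ∧ₐ t <ᵥ b)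

pairIn : (a b X : ℕ) → SOA
pairIn a b X = (((var a ⊕ var b) ⊗ (var a ⊕ var b)) ⊕ var a) ∈ₐ X

⋁ : {A : Set} → List A → (A → SOA) → SOA
⋁ [] f = ⊥ₐ
⋁ (x ∷ xs) f = f x ∨ₐ ⋁ xs f

⋀ : {A : Set} → List A → (A → SOA) → SOA
⋀ [] f = ⊤ₐ
⋀ (x ∷ xs) f = f x ∧ₐ ⋀ xs f

∀₁* : List ℕ → SOA → SOA
∀₁* [] φ = φ
∀₁* (n ∷ ns) φ = ∀₁ n (∀₁* ns φ)

∃₂* : List ℕ → SOA → SOA
∃₂* [] φ = φ
∃₂* (X ∷ Xs) φ = ∃₂ X (∃₂* Xs φ)

∀₂* : List ℕ → SOA → SOA
∀₂* [] φ = φ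
∀₂* (X ∷ Xs) φ = ∀₂ X (∀₂* Xs φ)

sat-⊥ₐ : ∀ e E → ¬ SatSOA e E ⊥ₐ
sat-⊥ₐ e E = <-irrefl refl

sat-⊤ₐ : ∀ e E → SatSOA e E ⊤ₐ
sat-⊤ₐ = sat-⊥ₐ

sat-<ᵥ : ∀ e E a b {a' b'} → e a ≡ a' → e b ≡ b' → SatSOA e E (a <ᵥ b) ⇔ (a' < b')
sat-<ᵥ e E a b refl refl = ⇔-refl

sat-≤ᵥ : ∀ e E a b {a' b'} → e a ≡ a' → e b ≡ b' → SatSOA e E (a ≤ᵥ b) ⇔ (a' ≤ b')
sat-≤ᵥ e E a b refl refl = mk⇔ ≮⇒≥ (λ le lt → <⇒≱ lt le)

sat-isZero : ∀ e E a {a'} → e a ≡ a' → SatSOA e E (isZero a) ⇔ (a' ≡ 0)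
sat-isZero e E a refl = mk⇔ (λ eq → +-cancelʳ-≡ (e a) (e a) 0 (sym eq)) (λ eq → trans eq (cong (λ z → z + z) (sym eq)))

sat-⋁ : ∀ {A : Set} e E (xs : List A) f → SatSOA e E (⋁ xs f) ⇔ (∃ λ x → x ∈ xs × SatSOA e E (f x))
sat-⋁ e E [] f = mk⇔ (λ s → ⊥-elim (sat-⊥ₐ e E s)) (λ ())
sat-⋁ e E (x ∷ xs) f = mk⇔ to' from'
  where
    to' : SatSOA e E (⋁ (x ∷ xs) f) → ∃ λ y → y ∈ x ∷ xs × SatSOA e E (f y)
    to' (inj₁ s) = x , here refl , s
    to' (inj₂ s) with y , y∈xs , s' ← to (sat-⋁ e E xs f) s = y , there y∈xs , s'
    from' : (∃ λ y → y ∈ x ∷ xs × SatSOA e E (f y)) → SatSOA e E (⋁ (x ∷ xs) f)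
    from' (y , here refl , s) = inj₁ s
    from' (y , there y∈xs , s) = inj₂ (from (sat-⋁ e E xs f) (y , y∈xs , s))

AgreeOutside : {A : Set} → List ℕ → (ℕ → A) → (ℕ → A) → Set
AgreeOutside ns f g = ∀ m → ¬ m ∈ ns → g m ≡ f m

agreeOutside-upd : {A : Set} {n : ℕ} {ns : List ℕ} (f g : ℕ → A) →
                   AgreeOutside (n ∷ ns) f g → AgreeOutside ns (upd f n (g n)) g
agreeOutside-upd {n = n} f g agree m m∉ns with m ≟ n
... | yes refl = sym (upd-same f m (g m))
... | no m≢n = trans (agree m λ { (here eq) → m≢n eq ; (there m∈ns) → m∉ns m∈ns }) (sym (upd-other f (g n) m≢n))

agreeOutside-∷ : {A : Set} {n : ℕ} {ns : List ℕ} (f : ℕ → A) (a : A) {g : ℕ → A} →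
                 AgreeOutside ns (upd f n a) g → AgreeOutside (n ∷ ns) f g
agreeOutside-∷ f a agree m m∉ = trans (agree m (λ m∈ → m∉ (there m∈))) (upd-other f a (λ eq → m∉ (here eq)))

∉-map-injective : {A : Set} {f : A → ℕ} → (∀ {a b} → f a ≡ f b → a ≡ b) → ∀ {y xs} → ¬ y ∈ xs → ¬ f y ∈ map f xs
∉-map-injective {f = f} f-inj {xs = xs} y∉ fy∈ with z , z∈ , eq ← ∈-map⁻ f fy∈ = y∉ (subst (_∈ xs) (sym (f-inj eq)) z∈)

updMany : {A I : Set} → (ℕ → A) → List I → (I → ℕ) → (I → A) → ℕ → A
updMany f [] idx g = f
updMany f (i ∷ is) idx g = upd (updMany f is idx g) (idx i) (g i)

updMany-in : {A I : Set} (f : ℕ → A) {idx : I → ℕ} (g : I → A) → (∀ {i j} → idx i ≡ idx j → i ≡ j) →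
             ∀ {i} is → i ∈ is → updMany f is idx g (idx i) ≡ g i
updMany-in f {idx} g idx-inj {i} (j ∷ is) i∈ with idx i ≟ idx j
... | yes eq = trans (cong (upd (updMany f is idx g) (idx j) (g j)) eq)
                     (trans (upd-same (updMany f is idx g) (idx j) (g j)) (cong g (sym (idx-inj eq))))
... | no neq with i∈
...   | here refl = ⊥-elim (neq refl)
...   | there i∈is = trans (upd-other (updMany f is idx g) (g j) neq) (updMany-in f g idx-inj is i∈is)

updMany-agree : {A I : Set} (f : ℕ → A) {idx : I → ℕ} (g : I → A) → ∀ is → AgreeOutside (map idx is) f (updMany f is idx g)
updMany-agree f g [] m m∉ = refl
updMany-agree f {idx} g (i ∷ is) m m∉ =
  trans (upd-other (updMany f is idx g) (g i) (λ eq → m∉ (here eq))) (updMany-agree f g is m (λ m∈ → m∉ (there m∈)))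

sat-∃₂* : ∀ e E Xs φ → SatSOA e E (∃₂* Xs φ) ⇔ (∃ λ E' → AgreeOutside Xs E E' × SatSOA e E' φ)
sat-∃₂* e E [] φ =
  mk⇔ (λ s → E , (λ _ _ → refl) , s)
      (λ (E' , agree , s) → from (SatSOA-cong (λ _ → refl) (λ X → sym (agree X (λ ()))) φ) s)
sat-∃₂* e E (X ∷ Xs) φ = mk⇔
  (λ (A , s) → let (E' , agree , s') = to (sat-∃₂* e (upd E X A) Xs φ) s in E' , agreeOutside-∷ E A agree , s')
  (λ (E' , agree , s') → E' X , from (sat-∃₂* e (upd E X (E' X)) Xs φ) (E' , agreeOutside-upd E E' agree , s'))

sat-∀₂* : ∀ e E Xs φ → SatSOA e E (∀₂* Xs φ) ⇔ (∀ E' → AgreeOutside Xs E E' → SatSOA e E' φ)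
sat-∀₂* e E [] φ =
  mk⇔ (λ s E' agree → to (SatSOA-cong (λ _ → refl) (λ X → sym (agree X (λ ()))) φ) s) (λ h → h E (λ _ _ → refl))
sat-∀₂* e E (X ∷ Xs) φ = mk⇔
  (λ h E' agree → to (sat-∀₂* e (upd E X (E' X)) Xs φ) (h (E' X)) E' (agreeOutside-upd E E' agree))
  (λ h A → from (sat-∀₂* e (upd E X A) Xs φ) (λ E' agree → h E' (agreeOutside-∷ E A agree)))

module Classical (lem : ExcludedMiddle 0ℓ) where

  sat-∧ₐ : ∀ e E A B → SatSOA e E (A ∧ₐ B) ⇔ (SatSOA e E A × SatSOA e E B)
  sat-∧ₐ e E A B = mk⇔
    (λ h → decidable-stable lem (λ ¬a → h (inj₁ ¬a)) , decidable-stable lem (λ ¬b → h (inj₂ ¬b)))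
    (λ { (a , b) (inj₁ ¬a) → ¬a a ; (a , b) (inj₂ ¬b) → ¬b b })

  sat-⇒ₐ : ∀ e E A B → SatSOA e E (A ⇒ₐ B) ⇔ (SatSOA e E A → SatSOA e E B)
  sat-⇒ₐ e E A B = mk⇔ (λ { (inj₁ ¬a) a → ⊥-elim (¬a a) ; (inj₂ b) _ → b }) from'
    where
      from' : (SatSOA e E A → SatSOA e E B) → SatSOA e E (A ⇒ₐ B)
      from' f with lem {SatSOA e E A}
      ... | yes a = inj₂ (f a)
      ... | no ¬a = inj₁ ¬a

  sat-∧ₐ-cong : ∀ e E A B {P Q : Set} → SatSOA e E A ⇔ P → SatSOA e E B ⇔ Q → SatSOA e E (A ∧ₐ B) ⇔ (P × Q)
  sat-∧ₐ-cong e E A B A⇔P B⇔Q = ⇔-trans (sat-∧ₐ e E A B) (A⇔P ×-⇔ B⇔Q)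

  sat-⇒ₐ-cong : ∀ e E A B {P Q : Set} → SatSOA e E A ⇔ P → SatSOA e E B ⇔ Q → SatSOA e E (A ⇒ₐ B) ⇔ (P → Q)
  sat-⇒ₐ-cong e E A B A⇔P B⇔Q = ⇔-trans (sat-⇒ₐ e E A B) (→-cong-⇔ A⇔P B⇔Q)

  sat-∧⇒ₐ-cong : ∀ e E A B C {P Q R : Set} → SatSOA e E A ⇔ P → SatSOA e E B ⇔ Q → SatSOA e E C ⇔ R →
                 SatSOA e E (A ∧ₐ B ⇒ₐ C) ⇔ (P → Q → R)
  sat-∧⇒ₐ-cong e E A B C A⇔P B⇔Q C⇔R =
    ⇔-trans (sat-⇒ₐ e E (A ∧ₐ B) C) (⇔-trans (→-cong-⇔ (sat-∧ₐ-cong e E A B A⇔P B⇔Q) C⇔R) (mk⇔ curry uncurry))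

  sat-isSuc : ∀ e E a b t {a' b'} → a ≢ t → b ≢ t → e a ≡ a' → e b ≡ b' → SatSOA e E (isSuc a b t) ⇔ (b' ≡ suc a')
  sat-isSuc e E a b t a≢t b≢t refl refl = ⇔-trans (sat-∧ₐ e E (a <ᵥ b) (¬ₐ ∃₁ t (a <ᵥ t ∧ₐ t <ᵥ b))) (mk⇔ to' from')
    where
      sat-between : ∀ k → SatSOA (upd e t k) E (a <ᵥ t ∧ₐ t <ᵥ b) ⇔ (e a < k × k < e b)
      sat-between k = sat-∧ₐ-cong (upd e t k) E (a <ᵥ t) (t <ᵥ b)
        (sat-<ᵥ (upd e t k) E a t (upd-other e k a≢t) (upd-same e t k))
        (sat-<ᵥ (upd e t k) E t b (upd-same e t k) (upd-other e k b≢t))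

      to' : e a < e b × ¬ SatSOA e E (∃₁ t (a <ᵥ t ∧ₐ t <ᵥ b)) → e b ≡ suc (e a)
      to' (a<b , nothing-between) with m≤n⇒m<n∨m≡n a<b
      ... | inj₂ eq = sym eq
      ... | inj₁ a+1<b = ⊥-elim (nothing-between (suc (e a) , from (sat-between (suc (e a))) (≤-refl , a+1<b)))

      from' : e b ≡ suc (e a) → e a < e b × ¬ SatSOA e E (∃₁ t (a <ᵥ t ∧ₐ t <ᵥ b))
      from' eq = subst (e a <_) (sym eq) ≤-refl ,
        λ (k , s) → let (a<k , k<b) = to (sat-between k) s in <⇒≱ a<k (≤-pred (subst (k <_) eq k<b))

  sat-⋀ : ∀ {A : Set} e E (xs : List A) f → SatSOA e E (⋀ xs f) ⇔ (∀ x → x ∈ xs → SatSOA e E (f x))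
  sat-⋀ e E [] f = mk⇔ (λ _ _ ()) (λ _ → sat-⊤ₐ e E)
  sat-⋀ e E (x ∷ xs) f = ⇔-trans (sat-∧ₐ e E (f x) (⋀ xs f)) (mk⇔
    (λ { (s , r) y (here refl) → s ; (s , r) y (there y∈xs) → to (sat-⋀ e E xs f) r y y∈xs })
    (λ h → h x (here refl) , from (sat-⋀ e E xs f) (λ y y∈xs → h y (there y∈xs))))

maxVarₜ : Term → ℕ
maxVarₜ (var n) = n
maxVarₜ (s ⊕ t) = maxVarₜ s ⊔ maxVarₜ t
maxVarₜ (s ⊗ t) = maxVarₜ s ⊔ maxVarₜ t

maxVar₁ : SOA → ℕ
maxVar₁ (s <ₐ t) = maxVarₜ s ⊔ maxVarₜ t
maxVar₁ (s ≐ t) = maxVarₜ s ⊔ maxVarₜ t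
maxVar₁ (t ∈ₐ X) = maxVarₜ t
maxVar₁ (¬ₐ φ) = maxVar₁ φ
maxVar₁ (φ ∨ₐ ψ) = maxVar₁ φ ⊔ maxVar₁ ψ
maxVar₁ (∃₁ n φ) = maxVar₁ φ
maxVar₁ (∀₁ n φ) = maxVar₁ φ
maxVar₁ (∃₂ X φ) = maxVar₁ φ
maxVar₁ (∀₂ X φ) = maxVar₁ φ

maxVar₂ : SOA → ℕ
maxVar₂ (s <ₐ t) = 0
maxVar₂ (s ≐ t) = 0
maxVar₂ (t ∈ₐ X) = X
maxVar₂ (¬ₐ φ) = maxVar₂ φ
maxVar₂ (φ ∨ₐ ψ) = maxVar₂ φ ⊔ maxVar₂ ψ
maxVar₂ (∃₁ n φ) = maxVar₂ φ
maxVar₂ (∀₁ n φ) = maxVar₂ φ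
maxVar₂ (∃₂ X φ) = maxVar₂ φ
maxVar₂ (∀₂ X φ) = maxVar₂ φ

universalClosure : SOA → SOA
universalClosure φ = ∀₁* (upTo (suc (maxVar₁ φ))) (∀₂* (upTo (suc (maxVar₂ φ))) φ)

private
  Below : ℕ → List ℕ → Set
  Below k b = ∀ m → m ≤ k → m ∈ b

  below-⊔ˡ : ∀ {b} j k → Below (j ⊔ k) b → Below j b
  below-⊔ˡ j k h m m≤j = h m (≤-trans m≤j (m≤m⊔n j k))

  below-⊔ʳ : ∀ {b} j k → Below (j ⊔ k) b → Below k b
  below-⊔ʳ j k h m m≤k = h m (≤-trans m≤k (m≤n⊔m j k))

FreeInTerm-if-below : ∀ {b} t → Below (maxVarₜ t) b → FreeInTerm b t
FreeInTerm-if-below (var n) h = h n ≤-refl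
FreeInTerm-if-below (s ⊕ t) h =
  FreeInTerm-if-below s (below-⊔ˡ (maxVarₜ s) _ h) , FreeInTerm-if-below t (below-⊔ʳ _ (maxVarₜ t) h)
FreeInTerm-if-below (s ⊗ t) h =
  FreeInTerm-if-below s (below-⊔ˡ (maxVarₜ s) _ h) , FreeInTerm-if-below t (below-⊔ʳ _ (maxVarₜ t) h)

ClosedSOA-if-below : ∀ {b1 b2} φ → Below (maxVar₁ φ) b1 → Below (maxVar₂ φ) b2 → ClosedSOA b1 b2 φ
ClosedSOA-if-below (s <ₐ t) h1 h2 =
  FreeInTerm-if-below s (below-⊔ˡ (maxVarₜ s) _ h1) , FreeInTerm-if-below t (below-⊔ʳ _ (maxVarₜ t) h1)
ClosedSOA-if-below (s ≐ t) h1 h2 =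
  FreeInTerm-if-below s (below-⊔ˡ (maxVarₜ s) _ h1) , FreeInTerm-if-below t (below-⊔ʳ _ (maxVarₜ t) h1)
ClosedSOA-if-below (t ∈ₐ X) h1 h2 = FreeInTerm-if-below t h1 , h2 X ≤-refl
ClosedSOA-if-below (¬ₐ φ) h1 h2 = ClosedSOA-if-below φ h1 h2
ClosedSOA-if-below (φ ∨ₐ ψ) h1 h2 =
  ClosedSOA-if-below φ (below-⊔ˡ (maxVar₁ φ) _ h1) (below-⊔ˡ (maxVar₂ φ) _ h2) ,
  ClosedSOA-if-below ψ (below-⊔ʳ _ (maxVar₁ ψ) h1) (below-⊔ʳ _ (maxVar₂ ψ) h2)
ClosedSOA-if-below (∃₁ n φ) h1 h2 = ClosedSOA-if-below φ (λ m le → there (h1 m le)) h2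
ClosedSOA-if-below (∀₁ n φ) h1 h2 = ClosedSOA-if-below φ (λ m le → there (h1 m le)) h2
ClosedSOA-if-below (∃₂ X φ) h1 h2 = ClosedSOA-if-below φ h1 (λ m le → there (h2 m le))
ClosedSOA-if-below (∀₂ X φ) h1 h2 = ClosedSOA-if-below φ h1 (λ m le → there (h2 m le))

private
  shift-binder : {n : ℕ} {ns b1 b : List ℕ} → (∀ m → m ∈ ns ⊎ m ∈ n ∷ b1 → m ∈ b) →
                 ∀ m → m ∈ n ∷ ns ⊎ m ∈ b1 → m ∈ b
  shift-binder h m (inj₁ (here eq)) = h m (inj₂ (here eq))
  shift-binder h m (inj₁ (there m∈ns)) = h m (inj₁ m∈ns)
  shift-binder h m (inj₂ m∈b1) = h m (inj₂ (there m∈b1))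

ClosedSOA-∀₁* : ∀ ns {b1 b2} φ → (∀ b → (∀ m → m ∈ ns ⊎ m ∈ b1 → m ∈ b) → ClosedSOA b b2 φ) →
                ClosedSOA b1 b2 (∀₁* ns φ)
ClosedSOA-∀₁* [] {b1} φ h = h b1 λ { m (inj₂ m∈b1) → m∈b1 }
ClosedSOA-∀₁* (n ∷ ns) φ h = ClosedSOA-∀₁* ns φ (λ b sub → h b (shift-binder sub))

ClosedSOA-∀₂* : ∀ Xs {b1 b2} φ → (∀ b → (∀ m → m ∈ Xs ⊎ m ∈ b2 → m ∈ b) → ClosedSOA b1 b φ) →
                ClosedSOA b1 b2 (∀₂* Xs φ)
ClosedSOA-∀₂* [] {b2 = b2} φ h = h b2 λ { m (inj₂ m∈b2) → m∈b2 }
ClosedSOA-∀₂* (X ∷ Xs) φ h = ClosedSOA-∀₂* Xs φ (λ b sub → h b (shift-binder sub))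

universalClosure-sentence : ∀ φ → IsSOASentence (universalClosure φ)
universalClosure-sentence φ =
  ClosedSOA-∀₁* (upTo (suc (maxVar₁ φ))) _ λ b1 sub1 →
  ClosedSOA-∀₂* (upTo (suc (maxVar₂ φ))) φ λ b2 sub2 →
  ClosedSOA-if-below φ (λ m m≤ → sub1 m (inj₁ (∈-upTo⁺ (s≤s m≤)))) (λ m m≤ → sub2 m (inj₁ (∈-upTo⁺ (s≤s m≤))))

∀₁*-intro : ∀ {E} ns φ → (∀ e → SatSOA e E φ) → ∀ e → SatSOA e E (∀₁* ns φ)
∀₁*-intro [] φ h e = h e
∀₁*-intro (n ∷ ns) φ h e a = ∀₁*-intro ns φ h (upd e n a)

∀₁*-elim : ∀ {E} ns φ e → SatSOA e E (∀₁* ns φ) → ∃ λ e' → SatSOA e' E φ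
∀₁*-elim [] φ e s = e , s
∀₁*-elim (n ∷ ns) φ e s = ∀₁*-elim ns φ (upd e n 0) (s 0)

universalClosure-sat : ∀ φ {M : Set} → (∀ e E → M ⇔ SatSOA e E φ) → M ⇔ TrueSOA (universalClosure φ)
universalClosure-sat φ {M} h = mk⇔
  (λ m → ∀₁*-intro ns₁ (∀₂* ns₂ φ) (λ e → from (sat-∀₂* e _ ns₂ φ) (λ E _ → to (h e E) m)) _)
  (λ t → let (e , s) = ∀₁*-elim ns₁ (∀₂* ns₂ φ) _ t
         in from (h e _) (to (sat-∀₂* e _ ns₂ φ) s _ (λ _ _ → refl)))
  where
    ns₁ = upTo (suc (maxVar₁ φ))
    ns₂ = upTo (suc (maxVar₂ φ))

module Translation (T : TS) where

  vertices : List (Fin (size T))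
  vertices = allFin (size T)

  stateVars : Var → List ℕ
  stateVars x = map (stateVar x) vertices

  inState : Var → ℕ → Fin (size T) → SOA
  inState x i v = var i ∈ₐ stateVar x v

  hasLabel : Var → ℕ → ℕ → SOA
  hasLabel x p i = ⋁ (filter (λ v → p ∈? label T v) vertices) (inState x i)

  -- θ holds in the trace of x at the position held by tmpVar i; the tmpVars from n on are free for binding.
  pltl : Var → PLTL → (i n : ℕ) → SOA
  pltl x (atom p) i n = hasLabel x p (tmpVar i)
  pltl x (¬ₚ θ) i n = ¬ₐ pltl x θ i n
  pltl x (θ ∨ₚ θ') i n = pltl x θ i n ∨ₐ pltl x θ' i n
  pltl x (Xₚ θ) i n = ∃₁ (tmpVar n) (isSuc (tmpVar i) (tmpVar n) (tmpVar (suc n)) ∧ₐ pltl x θ n (suc n))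
  pltl x (θ Uₚ θ') i n = ∃₁ (tmpVar n) (tmpVar i ≤ᵥ tmpVar n ∧ₐ pltl x θ' n (suc n) ∧ₐ
    ∀₁ (tmpVar (suc n)) (tmpVar i ≤ᵥ tmpVar (suc n) ∧ₐ tmpVar (suc n) <ᵥ tmpVar n ⇒ₐ pltl x θ (suc n) (suc (suc n))))
  pltl x (Yₚ θ) i n = ∃₁ (tmpVar n) (isSuc (tmpVar n) (tmpVar i) (tmpVar (suc n)) ∧ₐ pltl x θ n (suc n))
  pltl x (θ Sₚ θ') i n = ∃₁ (tmpVar n) (tmpVar n ≤ᵥ tmpVar i ∧ₐ pltl x θ' n (suc n) ∧ₐ
    ∀₁ (tmpVar (suc n)) (tmpVar n <ᵥ tmpVar (suc n) ∧ₐ tmpVar (suc n) ≤ᵥ tmpVar i ⇒ₐ pltl x θ (suc n) (suc (suc n))))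

  changes : Var → PLTL → (j i n : ℕ) → SOA
  changes x θ j i n = (pltl x θ j n ∧ₐ ¬ₐ pltl x θ i n) ∨ₐ ((¬ₐ pltl x θ j n) ∧ₐ pltl x θ i n)

  properCP : Var → List PLTL → (i n : ℕ) → SOA
  properCP x Γ i n = isZero (tmpVar i) ∨ₐ
    ∃₁ (tmpVar n) (isSuc (tmpVar n) (tmpVar i) (tmpVar (suc n)) ∧ₐ ⋁ Γ (λ θ → changes x θ n i (suc n)))

  changepoint : Var → List PLTL → (i n : ℕ) → SOA
  changepoint x Γ i n = properCP x Γ i n ∨ₐ ∃₁ (tmpVar n) (properCP x Γ n (suc n) ∧ₐ
    ∀₁ (tmpVar (suc n)) (properCP x Γ (suc n) (suc (suc n)) ⇒ₐ tmpVar (suc n) ≤ᵥ tmpVar n) ∧ₐ tmpVar n <ᵥ tmpVar i)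

  adjacentCP : Var → List PLTL → (lo hi c n : ℕ) → SOA
  adjacentCP x Γ lo hi c n = tmpVar lo <ᵥ tmpVar hi ∧ₐ changepoint x Γ c n ∧ₐ
    ∀₁ (tmpVar n) (tmpVar lo <ᵥ tmpVar n ∧ₐ tmpVar n <ᵥ tmpVar hi ⇒ₐ ¬ₐ changepoint x Γ n (suc n))

  -- Moves of x from tmpVar 3 to tmpVar 4, binding tmpVars from 5 on.
  succMove predMove : List PLTL → Var → SOA
  succMove Γ x = adjacentCP x Γ 3 4 4 5
  predMove Γ x = adjacentCP x Γ 4 3 4 5

  covers : Var → SOA
  covers x = ∀₁ (tmpVar 0) (⋁ vertices (inState x (tmpVar 0)))

  disjoint : Var → SOA
  disjoint x = ∀₁ (tmpVar 0) (⋀ vertices λ v → ⋀ (filter (λ w → ¬? (v ≟ᶠ w)) vertices) λ w →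
    ¬ₐ (inState x (tmpVar 0) v ∧ₐ inState x (tmpVar 0) w))

  startsInitial : Var → SOA
  startsInitial x = ∀₁ (tmpVar 0) (isZero (tmpVar 0) ⇒ₐ
    ⋁ (filter (λ v → init T v ≟ᵇ true) vertices) (inState x (tmpVar 0)))

  followsEdges : Var → SOA
  followsEdges x = ∀₁ (tmpVar 0) (∀₁ (tmpVar 1) (isSuc (tmpVar 0) (tmpVar 1) (tmpVar 2) ⇒ₐ
    ⋁ vertices λ v → ⋁ (filter (λ w → edge T v w ≟ᵇ true) vertices) λ w →
      inState x (tmpVar 0) v ∧ₐ inState x (tmpVar 1) w))

  encodesRun : Var → SOA
  encodesRun x = covers x ∧ₐ disjoint x ∧ₐ startsInitial x ∧ₐ followsEdges x

  -- An iteration of k = tmpVar 0 moves (k = 1 for X and Y, enforced by count) is guessed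
  -- as the sets stepVar x of pairs (j , position of x after j moves), one for each
  -- variable x of the context.
  startsAtPos : Var → SOA
  startsAtPos x = ∀₁ (tmpVar 1) (isZero (tmpVar 1) ⇒ₐ pairIn (tmpVar 1) (posVar x) (stepVar x))

  definedUpTo : Var → SOA
  definedUpTo x = ∀₁ (tmpVar 1) (tmpVar 1 ≤ᵥ tmpVar 0 ⇒ₐ ∃₁ (tmpVar 2) (pairIn (tmpVar 1) (tmpVar 2) (stepVar x)))

  movesBy : (Var → SOA) → Var → SOA
  movesBy move x = ∀₁ (tmpVar 1) (∀₁ (tmpVar 2) (∀₁ (tmpVar 3) (∀₁ (tmpVar 4)
    (tmpVar 1 <ᵥ tmpVar 0 ∧ₐ isSuc (tmpVar 1) (tmpVar 2) (tmpVar 5) ∧ₐ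
     pairIn (tmpVar 1) (tmpVar 3) (stepVar x) ∧ₐ pairIn (tmpVar 2) (tmpVar 4) (stepVar x) ⇒ₐ move x))))

  isIteration : List Var → (Var → SOA) → SOA
  isIteration xs move = ⋀ xs λ x → startsAtPos x ∧ₐ definedUpTo x ∧ₐ movesBy move x

  -- φ holds whichever positions the stepVars assign at step tmpVar J.
  atStep : List Var → ℕ → SOA → SOA
  atStep [] J φ = φ
  atStep (x ∷ xs) J φ = ∀₁ (posVar x) (pairIn (tmpVar J) (posVar x) (stepVar x) ⇒ₐ atStep xs J φ)

  iterateUntil : List Var → (Var → SOA) → (count ψ φ : SOA) → SOA
  iterateUntil xs move count ψ φ = ∃₁ (tmpVar 0) (count ∧ₐ ∃₂* (map stepVar xs)
    (isIteration xs move ∧ₐ atStep xs 0 ψ ∧ₐ ∀₁ (tmpVar 1) (tmpVar 1 <ᵥ tmpVar 0 ⇒ₐ atStep xs 1 φ)))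

  countIsOne : SOA
  countIsOne = ∃₁ (tmpVar 1) (isZero (tmpVar 1) ∧ₐ isSuc (tmpVar 1) (tmpVar 0) (tmpVar 2))

  inContext : Ctx → List Var → List Var
  inContext c = filter (λ x → c x ≟ᵇ true)

  -- bs lists the trace variables bound so far.
  encode : List Var → Ctx → GHy → SOA
  encode bs c (ap p x) = if does (x ∈? bs) then hasLabel x p (posVar x) else ⊥ₐ
  encode bs c (¬ₕ φ) = ¬ₐ encode bs c φ
  encode bs c (φ ∨ₕ ψ) = encode bs c φ ∨ₐ encode bs c ψ
  encode bs c (⟨ C ⟩ φ) = encode bs (ctxOf C) φ
  encode bs c (Xₕ Γ φ) = iterateUntil (inContext c bs) (succMove Γ) countIsOne (encode bs c φ) ⊤ₐ
  encode bs c (Uₕ Γ φ ψ) = iterateUntil (inContext c bs) (succMove Γ) ⊤ₐ (encode bs c ψ) (encode bs c φ)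
  encode bs c (Yₕ Γ φ) = iterateUntil (inContext c bs) (predMove Γ) countIsOne (encode bs c φ) ⊤ₐ
  encode bs c (Sₕ Γ φ ψ) = iterateUntil (inContext c bs) (predMove Γ) ⊤ₐ (encode bs c ψ) (encode bs c φ)
  encode bs c (∃ₕ x φ) =
    ∃₂* (stateVars x) (∃₁ (posVar x) (isZero (posVar x) ∧ₐ encodesRun x ∧ₐ encode (x ∷ bs) c φ))
  encode bs c (∀ₕ x φ) =
    ∀₂* (stateVars x) (∀₁ (posVar x) (isZero (posVar x) ⇒ₐ encodesRun x ⇒ₐ encode (x ∷ bs) c φ))

reduction : MCInstance → SOA
reduction (T , (φ , _)) = universalClosure (Translation.encode T [] allVars φ)

module Correctness (T : TS) (lem : ExcludedMiddle 0ℓ) where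
  open Translation T
  open Classical lem

  Vertex : Set
  Vertex = Fin (size T)

  record Visits (ρ : ℕ → Vertex) (G : Vertex → Subset) : Set where
    constructor mkVisits
    field
      visited : ∀ i → G (ρ i) i ≡ true
      only    : ∀ i v → G v i ≡ true → ρ i ≡ v

  record Represents (σ : Trace) (G : Vertex → Subset) : Set where
    constructor mkRepresents
    field
      run    : ℕ → Vertex
      labels : ∀ i → σ i ≡ label T (run i)
      visits : Visits run G

  statesOf : (ℕ → Subset) → Var → Vertex → Subset
  statesOf E x v = E (stateVar x v)

  module PLTLSemantics {σ : Trace} {x : Var} {E : ℕ → Subset} (rep : Represents σ (statesOf E x)) where
    open Represents rep
    open Visits visits

    hasLabel-sat : ∀ e p i → SatSOA e E (hasLabel x p i) ⇔ (p ∈ σ (e i))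
    hasLabel-sat e p i = ⇔-trans (sat-⋁ e E (filter p∈? vertices) (inState x i)) (mk⇔ to' from')
      where
        p∈? = λ v → p ∈? label T v

        to' : (∃ λ v → v ∈ filter p∈? vertices × E (stateVar x v) (e i) ≡ true) → p ∈ σ (e i)
        to' (v , v∈ , inV) =
          subst (p ∈_) (sym (trans (labels (e i)) (cong (label T) (only (e i) v inV)))) (proj₂ (∈-filter⁻ p∈? {xs = vertices} v∈))

        from' : p ∈ σ (e i) → ∃ λ v → v ∈ filter p∈? vertices × E (stateVar x v) (e i) ≡ true
        from' p∈ = run (e i) , ∈-filter⁺ p∈? {xs = vertices} (∈-allFin _) (subst (p ∈_) (labels (e i)) p∈) , visited (e i)

    pltl-sat : ∀ θ {i n e a} → i < n → e (tmpVar i) ≡ a → SatSOA e E (pltl x θ i n) ⇔ (σ , a ⊨ₚ θ)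
    pltl-sat (atom p) {i} {e = e} i<n refl = hasLabel-sat e p (tmpVar i)
    pltl-sat (¬ₚ θ) i<n ea = ¬-cong-⇔ (pltl-sat θ i<n ea)
    pltl-sat (θ ∨ₚ θ') i<n ea = pltl-sat θ i<n ea ⊎-⇔ pltl-sat θ' i<n ea
    pltl-sat (Xₚ θ) {i} {n} {e} {a} i<n ea =
      ⇔-trans (Σ-cong-⇔ λ b → sat-∧ₐ-cong (e₁ b) E (isSuc tᵢ tₙ tₙ₊₁) (pltl x θ n (suc n))
                (sat-isSuc (e₁ b) E tᵢ tₙ tₙ₊₁ (tmpVar-<-≢ (m<n⇒m<1+n i<n)) (tmpVar-<-≢ ≤-refl)
                   (upd-tmpVar-< e b i<n ea) (upd-same e tₙ b))
                (pltl-sat θ ≤-refl (upd-same e tₙ b)))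
        (mk⇔ (λ { (_ , refl , holds) → holds }) (λ holds → suc a , refl , holds))
      where
        tᵢ = tmpVar i
        tₙ = tmpVar n
        tₙ₊₁ = tmpVar (suc n)
        e₁ = λ b → upd e tₙ b
    pltl-sat (Yₚ θ) {i} {n} {e} {a} i<n ea =
      ⇔-trans (Σ-cong-⇔ λ b → sat-∧ₐ-cong (e₁ b) E (isSuc tₙ tᵢ tₙ₊₁) (pltl x θ n (suc n))
                (sat-isSuc (e₁ b) E tₙ tᵢ tₙ₊₁ (tmpVar-<-≢ ≤-refl) (tmpVar-<-≢ (m<n⇒m<1+n i<n))
                   (upd-same e tₙ b) (upd-tmpVar-< e b i<n ea))
                (pltl-sat θ ≤-refl (upd-same e tₙ b)))
        (previous a)
      where
        tᵢ = tmpVar i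
        tₙ = tmpVar n
        tₙ₊₁ = tmpVar (suc n)
        e₁ = λ b → upd e tₙ b
        previous : ∀ a → (∃ λ b → a ≡ suc b × σ , b ⊨ₚ θ) ⇔ (σ , a ⊨ₚ Yₚ θ)
        previous zero = mk⇔ (λ ()) (λ ())
        previous (suc a) = mk⇔ (λ { (_ , refl , holds) → holds }) (λ holds → a , refl , holds)
    pltl-sat (θ Uₚ θ') {i} {n} {e} {a} i<n ea =
      Σ-cong-⇔ λ b → sat-∧ₐ-cong (e₁ b) E (tᵢ ≤ᵥ tₙ) (pltl x θ' n (suc n) ∧ₐ between)
        (sat-≤ᵥ (e₁ b) E tᵢ tₙ (upd-tmpVar-< e b i<n ea) (upd-same e tₙ b))
        (sat-∧ₐ-cong (e₁ b) E (pltl x θ' n (suc n)) between (pltl-sat θ' ≤-refl (upd-same e tₙ b))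
          (Π-cong-⇔ λ j → sat-∧⇒ₐ-cong (e₂ b j) E (tᵢ ≤ᵥ tₙ₊₁) (tₙ₊₁ <ᵥ tₙ) (pltl x θ (suc n) (suc (suc n)))
             (sat-≤ᵥ (e₂ b j) E tᵢ tₙ₊₁ (upd-tmpVar-< (e₁ b) j (m<n⇒m<1+n i<n) (upd-tmpVar-< e b i<n ea))
                (upd-same (e₁ b) tₙ₊₁ j))
             (sat-<ᵥ (e₂ b j) E tₙ₊₁ tₙ (upd-same (e₁ b) tₙ₊₁ j) (upd-tmpVar-< (e₁ b) {i = n} j ≤-refl (upd-same e tₙ b)))
             (pltl-sat θ ≤-refl (upd-same (e₁ b) tₙ₊₁ j))))
      where
        tᵢ = tmpVar i
        tₙ = tmpVar n
        tₙ₊₁ = tmpVar (suc n)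
        e₁ = λ b → upd e tₙ b
        e₂ = λ b j → upd (e₁ b) tₙ₊₁ j
        between = ∀₁ tₙ₊₁ (tᵢ ≤ᵥ tₙ₊₁ ∧ₐ tₙ₊₁ <ᵥ tₙ ⇒ₐ pltl x θ (suc n) (suc (suc n)))
    pltl-sat (θ Sₚ θ') {i} {n} {e} {a} i<n ea =
      Σ-cong-⇔ λ b → sat-∧ₐ-cong (e₁ b) E (tₙ ≤ᵥ tᵢ) (pltl x θ' n (suc n) ∧ₐ between)
        (sat-≤ᵥ (e₁ b) E tₙ tᵢ (upd-same e tₙ b) (upd-tmpVar-< e b i<n ea))
        (sat-∧ₐ-cong (e₁ b) E (pltl x θ' n (suc n)) between (pltl-sat θ' ≤-refl (upd-same e tₙ b))
          (Π-cong-⇔ λ j → sat-∧⇒ₐ-cong (e₂ b j) E (tₙ <ᵥ tₙ₊₁) (tₙ₊₁ ≤ᵥ tᵢ) (pltl x θ (suc n) (suc (suc n)))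
             (sat-<ᵥ (e₂ b j) E tₙ tₙ₊₁ (upd-tmpVar-< (e₁ b) {i = n} j ≤-refl (upd-same e tₙ b)) (upd-same (e₁ b) tₙ₊₁ j))
             (sat-≤ᵥ (e₂ b j) E tₙ₊₁ tᵢ (upd-same (e₁ b) tₙ₊₁ j)
                (upd-tmpVar-< (e₁ b) j (m<n⇒m<1+n i<n) (upd-tmpVar-< e b i<n ea)))
             (pltl-sat θ ≤-refl (upd-same (e₁ b) tₙ₊₁ j))))
      where
        tᵢ = tmpVar i
        tₙ = tmpVar n
        tₙ₊₁ = tmpVar (suc n)
        e₁ = λ b → upd e tₙ b
        e₂ = λ b j → upd (e₁ b) tₙ₊₁ j
        between = ∀₁ tₙ₊₁ (tₙ <ᵥ tₙ₊₁ ∧ₐ tₙ₊₁ ≤ᵥ tᵢ ⇒ₐ pltl x θ (suc n) (suc (suc n)))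

    module _ (Γ : List PLTL) where

      changes-sat : ∀ θ {j i n e b} → j < n → i < n → e (tmpVar j) ≡ b → e (tmpVar i) ≡ suc b →
                    SatSOA e E (changes x θ j i n) ⇔ ChangesAt σ b θ
      changes-sat θ {j} {i} {n} {e} j<n i<n eb ei =
        sat-∧ₐ-cong e E (pltl x θ j n) (¬ₐ pltl x θ i n) θ-at-j (¬-cong-⇔ θ-at-i) ⊎-⇔
        sat-∧ₐ-cong e E (¬ₐ pltl x θ j n) (pltl x θ i n) (¬-cong-⇔ θ-at-j) θ-at-i
        where
          θ-at-j = pltl-sat θ j<n eb
          θ-at-i = pltl-sat θ i<n ei

      properCP-sat : ∀ {i n e a} → i < n → e (tmpVar i) ≡ a → SatSOA e E (properCP x Γ i n) ⇔ ProperCP Γ σ a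
      properCP-sat {i} {n} {e} {a} i<n ea =
        sat-isZero e E tᵢ ea ⊎-⇔
        (Σ-cong-⇔ λ b → ⇔-trans (sat-∧ₐ (e₁ b) E (isSuc tₙ tᵢ tₙ₊₁) (⋁ Γ (λ θ → changes x θ n i (suc n))))
           (×-dep-⇔ (sat-isSuc (e₁ b) E tₙ tᵢ tₙ₊₁ (tmpVar-<-≢ ≤-refl) (tmpVar-<-≢ (m<n⇒m<1+n i<n))
                       (upd-same e tₙ b) (upd-tmpVar-< e b i<n ea))
              λ a≡1+b → ⇔-trans (sat-⋁ (e₁ b) E Γ (λ θ → changes x θ n i (suc n)))
                (Σ-cong-⇔ λ θ → ⇔-refl ×-⇔
                   changes-sat θ ≤-refl (m<n⇒m<1+n i<n) (upd-same e tₙ b) (upd-tmpVar-< e b i<n (trans ea a≡1+b)))))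
        where
          tᵢ = tmpVar i
          tₙ = tmpVar n
          tₙ₊₁ = tmpVar (suc n)
          e₁ = λ b → upd e tₙ b

      changepoint-sat : ∀ {i n e a} → i < n → e (tmpVar i) ≡ a → SatSOA e E (changepoint x Γ i n) ⇔ CP Γ σ a
      changepoint-sat {i} {n} {e} {a} i<n ea =
        properCP-sat i<n ea ⊎-⇔
        (Σ-cong-⇔ λ m → sat-∧ₐ-cong (e₁ m) E (properCP x Γ n (suc n)) (isLast ∧ₐ tₙ <ᵥ tᵢ)
          (properCP-sat ≤-refl (upd-same e tₙ m))
          (sat-∧ₐ-cong (e₁ m) E isLast (tₙ <ᵥ tᵢ)
             (Π-cong-⇔ λ k → sat-⇒ₐ-cong (e₂ m k) E (properCP x Γ (suc n) (suc (suc n))) (tₙ₊₁ ≤ᵥ tₙ)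
                (properCP-sat ≤-refl (upd-same (e₁ m) tₙ₊₁ k))
                (sat-≤ᵥ (e₂ m k) E tₙ₊₁ tₙ (upd-same (e₁ m) tₙ₊₁ k)
                   (upd-tmpVar-< (e₁ m) {i = n} k ≤-refl (upd-same e tₙ m))))
             (sat-<ᵥ (e₁ m) E tₙ tᵢ (upd-same e tₙ m) (upd-tmpVar-< e m i<n ea))))
        where
          tᵢ = tmpVar i
          tₙ = tmpVar n
          tₙ₊₁ = tmpVar (suc n)
          e₁ = λ m → upd e tₙ m
          e₂ = λ m k → upd (e₁ m) tₙ₊₁ k
          isLast = ∀₁ tₙ₊₁ (properCP x Γ (suc n) (suc (suc n)) ⇒ₐ tₙ₊₁ ≤ᵥ tₙ)

      adjacentCP-sat : ∀ {lo hi c n e a b d} → lo < n → hi < n → c < n →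
                       e (tmpVar lo) ≡ a → e (tmpVar hi) ≡ b → e (tmpVar c) ≡ d →
                       SatSOA e E (adjacentCP x Γ lo hi c n) ⇔
                       (a < b × CP Γ σ d × (∀ k → a < k → k < b → ¬ CP Γ σ k))
      adjacentCP-sat {lo} {hi} {c} {n} {e} lo<n hi<n c<n ea eb ed =
        sat-∧ₐ-cong e E (tₗ <ᵥ tₕ) (changepoint x Γ c n ∧ₐ noneBetween) (sat-<ᵥ e E tₗ tₕ ea eb)
          (sat-∧ₐ-cong e E (changepoint x Γ c n) noneBetween (changepoint-sat c<n ed)
            (Π-cong-⇔ λ k → sat-∧⇒ₐ-cong (e₁ k) E (tₗ <ᵥ tₙ) (tₙ <ᵥ tₕ) (¬ₐ changepoint x Γ n (suc n))
               (sat-<ᵥ (e₁ k) E tₗ tₙ (upd-tmpVar-< e k lo<n ea) (upd-same e tₙ k))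
               (sat-<ᵥ (e₁ k) E tₙ tₕ (upd-same e tₙ k) (upd-tmpVar-< e k hi<n eb))
               (¬-cong-⇔ (changepoint-sat ≤-refl (upd-same e tₙ k)))))
        where
          tₗ = tmpVar lo
          tₕ = tmpVar hi
          tₙ = tmpVar n
          e₁ = λ k → upd e tₙ k
          noneBetween = ∀₁ tₙ (tₗ <ᵥ tₙ ∧ₐ tₙ <ᵥ tₕ ⇒ₐ ¬ₐ changepoint x Γ n (suc n))

      succMove-sat : ∀ e {a b} → e (tmpVar 3) ≡ a → e (tmpVar 4) ≡ b → SatSOA e E (succMove Γ x) ⇔ IsSucc Γ σ a b
      succMove-sat e ea eb = adjacentCP-sat (from-yes (3 <? 5)) (from-yes (4 <? 5)) (from-yes (4 <? 5)) ea eb eb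

      predMove-sat : ∀ e {a b} → e (tmpVar 3) ≡ a → e (tmpVar 4) ≡ b → SatSOA e E (predMove Γ x) ⇔ IsPred Γ σ a b
      predMove-sat e ea eb = adjacentCP-sat (from-yes (4 <? 5)) (from-yes (3 <? 5)) (from-yes (4 <? 5)) eb ea eb

  record IsRunSets (G : Vertex → Subset) : Set where
    field
      covered     : ∀ i → ∃ λ v → G v i ≡ true
      unique      : ∀ i v w → G v i ≡ true → G w i ≡ true → v ≡ w
      initial     : ∃ λ v → init T v ≡ true × G v 0 ≡ true
      consecutive : ∀ i → ∃ λ v → ∃ λ w → edge T v w ≡ true × G v i ≡ true × G w (suc i) ≡ true

  isRunSets⇒run : ∀ {G} → IsRunSets G → ∃ λ ρ → IsRun T ρ × Visits ρ G
  isRunSets⇒run {G} sets = ρ , (starts , steps) , mkVisits (λ i → proj₂ (covered i)) onlyρ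
    where
      open IsRunSets sets
      ρ = λ i → proj₁ (covered i)
      onlyρ : ∀ i v → G v i ≡ true → ρ i ≡ v
      onlyρ i v = unique i (ρ i) v (proj₂ (covered i))
      starts : init T (ρ 0) ≡ true
      starts with v , initV , inV ← initial = subst (λ w → init T w ≡ true) (sym (onlyρ 0 v inV)) initV
      steps : ∀ i → edge T (ρ i) (ρ (suc i)) ≡ true
      steps i with v , w , vw , inV , inW ← consecutive i =
        subst₂ (λ v w → edge T v w ≡ true) (sym (onlyρ i v inV)) (sym (onlyρ (suc i) w inW)) vw

  run⇒isRunSets : ∀ {ρ G} → IsRun T ρ → Visits ρ G → IsRunSets G
  run⇒isRunSets {ρ} (starts , steps) (mkVisits visited only) = record
    { covered = λ i → ρ i , visited i
    ; unique = λ i v w inV inW → trans (sym (only i v inV)) (only i w inW)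
    ; initial = ρ 0 , starts , visited 0
    ; consecutive = λ i → ρ i , ρ (suc i) , steps i , visited i , visited (suc i)
    }

  visitSets : (ℕ → Vertex) → Vertex → Subset
  visitSets ρ v i = does (ρ i ≟ᶠ v)

  visitSets-visits : ∀ ρ → Visits ρ (visitSets ρ)
  visitSets-visits ρ = mkVisits (λ i → dec-true (ρ i ≟ᶠ ρ i) refl) only
    where
      only : ∀ i v → does (ρ i ≟ᶠ v) ≡ true → ρ i ≡ v
      only i v _ with yes ρi≡v ← ρ i ≟ᶠ v = ρi≡v

  module _ (x : Var) (e : ℕ → ℕ) (E : ℕ → Subset) where
    private
      G = statesOf E x
      t₀ = tmpVar 0
      t₁ = tmpVar 1

    covers-sat : SatSOA e E (covers x) ⇔ (∀ i → ∃ λ v → G v i ≡ true)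
    covers-sat = Π-cong-⇔ λ i → ⇔-trans (sat-⋁ (upd e t₀ i) E vertices (inState x t₀))
      (mk⇔ (λ (v , _ , inV) → v , inV) (λ (v , inV) → v , ∈-allFin v , inV))

    disjoint-sat : SatSOA e E (disjoint x) ⇔ (∀ i v w → G v i ≡ true → G w i ≡ true → v ≡ w)
    disjoint-sat = Π-cong-⇔ λ i → ⇔-trans (sat-pairwise i) (mk⇔ (to' i) (from' i))
      where
        others = λ v → filter (λ w → ¬? (v ≟ᶠ w)) vertices
        notBoth = λ v w → ¬ₐ (inState x t₀ v ∧ₐ inState x t₀ w)

        sat-pairwise : ∀ i → SatSOA (upd e t₀ i) E (⋀ vertices λ v → ⋀ (others v) (notBoth v)) ⇔
                       (∀ v → v ∈ vertices → ∀ w → w ∈ others v → ¬ (G v i ≡ true × G w i ≡ true))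
        sat-pairwise i = ⇔-trans (sat-⋀ (upd e t₀ i) E vertices _) (Π-cong-⇔ λ v → →-cong-⇔ ⇔-refl
          (⇔-trans (sat-⋀ (upd e t₀ i) E (others v) (notBoth v)) (Π-cong-⇔ λ w → →-cong-⇔ ⇔-refl
            (¬-cong-⇔ (sat-∧ₐ (upd e t₀ i) E (inState x t₀ v) (inState x t₀ w))))))

        to' : ∀ i → (∀ v → v ∈ vertices → ∀ w → w ∈ others v → ¬ (G v i ≡ true × G w i ≡ true)) →
              ∀ v w → G v i ≡ true → G w i ≡ true → v ≡ w
        to' i h v w inV inW with v ≟ᶠ w
        ... | yes v≡w = v≡w
        ... | no v≢w = ⊥-elim (h v (∈-allFin v) w (∈-filter⁺ (λ w → ¬? (v ≟ᶠ w)) {xs = vertices} (∈-allFin w) v≢w) (inV , inW))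

        from' : ∀ i → (∀ v w → G v i ≡ true → G w i ≡ true → v ≡ w) →
                ∀ v → v ∈ vertices → ∀ w → w ∈ others v → ¬ (G v i ≡ true × G w i ≡ true)
        from' i h v _ w w∈ (inV , inW) = proj₂ (∈-filter⁻ (λ w → ¬? (v ≟ᶠ w)) {xs = vertices} w∈) (h v w inV inW)

    startsInitial-sat : SatSOA e E (startsInitial x) ⇔ (∃ λ v → init T v ≡ true × G v 0 ≡ true)
    startsInitial-sat = mk⇔ to' from'
      where
        initial? = λ v → init T v ≟ᵇ true

        to' : SatSOA e E (startsInitial x) → ∃ λ v → init T v ≡ true × G v 0 ≡ true
        to' h with v , v∈ , inV ← to (sat-⋁ (upd e t₀ 0) E (filter initial? vertices) (inState x t₀))
                                     (to (sat-⇒ₐ (upd e t₀ 0) E (isZero t₀) _) (h 0) (from (sat-isZero (upd e t₀ 0) E t₀ refl) refl))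
          = v , proj₂ (∈-filter⁻ initial? {xs = vertices} v∈) , inV

        from' : (∃ λ v → init T v ≡ true × G v 0 ≡ true) → SatSOA e E (startsInitial x)
        from' (v , initV , inV) a = from (sat-⇒ₐ (upd e t₀ a) E (isZero t₀) _) λ z →
          from (sat-⋁ (upd e t₀ a) E (filter initial? vertices) (inState x t₀))
            (v , ∈-filter⁺ initial? {xs = vertices} (∈-allFin v) initV ,
             subst (λ k → G v k ≡ true) (sym (to (sat-isZero (upd e t₀ a) E t₀ refl) z)) inV)

    followsEdges-sat : SatSOA e E (followsEdges x) ⇔
                       (∀ i → ∃ λ v → ∃ λ w → edge T v w ≡ true × G v i ≡ true × G w (suc i) ≡ true)
    followsEdges-sat = mk⇔ to' from'
      where
        e₂ = λ a b → upd (upd e t₀ a) t₁ b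
        edge? = λ v w → edge T v w ≟ᵇ true
        pairs = λ v → ⋁ (filter (edge? v) vertices) λ w → inState x t₀ v ∧ₐ inState x t₁ w
        isNext = λ a b → sat-isSuc (e₂ a b) E t₀ t₁ (tmpVar 2) (λ ()) (λ ()) refl refl

        sat-pairs : ∀ a b → SatSOA (e₂ a b) E (⋁ vertices pairs) ⇔
                            (∃ λ v → ∃ λ w → edge T v w ≡ true × G v a ≡ true × G w b ≡ true)
        sat-pairs a b = ⇔-trans (sat-⋁ (e₂ a b) E vertices pairs) (mk⇔
          (λ (v , _ , s) → let (w , w∈ , s') = to (sat-⋁ (e₂ a b) E (filter (edge? v) vertices) _) s in
             v , w , proj₂ (∈-filter⁻ (edge? v) {xs = vertices} w∈) , to (sat-∧ₐ (e₂ a b) E (inState x t₀ v) (inState x t₁ w)) s')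
          (λ (v , w , vw , both) → v , ∈-allFin v ,
             from (sat-⋁ (e₂ a b) E (filter (edge? v) vertices) _)
               (w , ∈-filter⁺ (edge? v) {xs = vertices} (∈-allFin w) vw ,
                from (sat-∧ₐ (e₂ a b) E (inState x t₀ v) (inState x t₁ w)) both)))

        to' : SatSOA e E (followsEdges x) → ∀ i → ∃ λ v → ∃ λ w → edge T v w ≡ true × G v i ≡ true × G w (suc i) ≡ true
        to' h i = to (sat-pairs i (suc i))
          (to (sat-⇒ₐ (e₂ i (suc i)) E (isSuc t₀ t₁ (tmpVar 2)) _) (h i (suc i)) (from (isNext i (suc i)) refl))

        from' : (∀ i → ∃ λ v → ∃ λ w → edge T v w ≡ true × G v i ≡ true × G w (suc i) ≡ true) → SatSOA e E (followsEdges x)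
        from' h a b = from (sat-⇒ₐ (e₂ a b) E (isSuc t₀ t₁ (tmpVar 2)) _) λ next →
          from (sat-pairs a b) (subst (λ k → ∃ λ v → ∃ λ w → edge T v w ≡ true × G v a ≡ true × G w k ≡ true)
                                      (sym (to (isNext a b) next)) (h a))

    encodesRun-sat : SatSOA e E (encodesRun x) ⇔ IsRunSets G
    encodesRun-sat = ⇔-trans
      (sat-∧ₐ-cong e E (covers x) (disjoint x ∧ₐ startsInitial x ∧ₐ followsEdges x) covers-sat
        (sat-∧ₐ-cong e E (disjoint x) (startsInitial x ∧ₐ followsEdges x) disjoint-sat
          (sat-∧ₐ-cong e E (startsInitial x) (followsEdges x) startsInitial-sat followsEdges-sat)))
      (mk⇔ (λ (c , u , i , s) → record { covered = c ; unique = u ; initial = i ; consecutive = s })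
              (λ sets → let open IsRunSets sets in covered , unique , initial , consecutive))

  record Encodes (bs : List Var) (Π : Assign) (e : ℕ → ℕ) (E : ℕ → Subset) : Set where
    field
      bound   : ∀ {y} → y ∈ bs → ∃ λ σ → Π y ≡ just (σ , e (posVar y)) × Represents σ (statesOf E y)
      unbound : ∀ {y} → ¬ y ∈ bs → Π y ≡ nothing

  Visits-cong : ∀ {ρ G G'} → (∀ v → G v ≡ G' v) → Visits ρ G → Visits ρ G'
  Visits-cong G≗G' (mkVisits visited only) = mkVisits
    (λ i → trans (cong (λ A → A i) (sym (G≗G' _))) (visited i))
    (λ i v inV → only i v (trans (cong (λ A → A i) (G≗G' v)) inV))

  Represents-cong : ∀ {σ G G'} → (∀ v → G v ≡ G' v) → Represents σ G → Represents σ G'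
  Represents-cong G≗G' (mkRepresents ρ labels visits) = mkRepresents ρ labels (Visits-cong G≗G' visits)

  posOf : Maybe (Trace × ℕ) → ℕ
  posOf nothing = 0
  posOf (just (_ , i)) = i

  setPos : Maybe (Trace × ℕ) → ℕ → Maybe (Trace × ℕ)
  setPos nothing a = nothing
  setPos (just (σ , _)) a = just (σ , a)

  setPos-posOf : ∀ m → setPos m (posOf m) ≡ m
  setPos-posOf nothing = refl
  setPos-posOf (just _) = refl

  encodes-moved : ∀ {bs Π e E Π' e' E'} (xs : List Var) → Encodes bs Π e E →
                  (∀ y v → E' (stateVar y v) ≡ E (stateVar y v)) →
                  (∀ {y} → y ∈ xs → Π' y ≡ setPos (Π y) (e' (posVar y))) →
                  (∀ {y} → ¬ y ∈ xs → Π' y ≡ Π y × e' (posVar y) ≡ e (posVar y)) →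
                  Encodes bs Π' e' E'
  encodes-moved {bs} {Π} {e} {E} {Π'} {e'} {E'} xs enc sameStates moved unmoved = record { bound = bound' ; unbound = unbound' }
    where
      open Encodes enc

      bound' : ∀ {y} → y ∈ bs → ∃ λ σ → Π' y ≡ just (σ , e' (posVar y)) × Represents σ (statesOf E' y)
      bound' {y} y∈bs with σ , Πy , rep ← bound y∈bs = σ , Π'y , Represents-cong (λ v → sym (sameStates y v)) rep
        where
          Π'y : Π' y ≡ just (σ , e' (posVar y))
          Π'y with y ∈? xs
          ... | yes y∈xs = trans (moved y∈xs) (cong (λ m → setPos m (e' (posVar y))) Πy)
          ... | no y∉xs = let (Π'≡Π , e'≡e) = unmoved y∉xs in trans Π'≡Π (trans Πy (cong (λ a → just (σ , a)) (sym e'≡e)))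

      unbound' : ∀ {y} → ¬ y ∈ bs → Π' y ≡ nothing
      unbound' {y} y∉bs with y ∈? xs
      ... | yes y∈xs = trans (moved y∈xs) (cong (λ m → setPos m (e' (posVar y))) (unbound y∉bs))
      ... | no y∉xs = trans (proj₁ (unmoved y∉xs)) (unbound y∉bs)

  MoveBy : (Trace → ℕ → ℕ → Set) → Bool → Maybe (Trace × ℕ) → Maybe (Trace × ℕ) → Set
  MoveBy R true nothing m' = m' ≡ nothing
  MoveBy R true (just (σ , i)) m' = ∃ λ j → R σ i j × m' ≡ just (σ , j)
  MoveBy R false m m' = m' ≡ m

  StepBy : (Trace → ℕ → ℕ → Set) → Ctx → Assign → Assign → Set
  StepBy R c Π Π' = ∀ x → MoveBy R (c x) (Π x) (Π' x)

  UntilBy : (Trace → ℕ → ℕ → Set) → Ctx → (Count : ℕ → Set) → (Φ Ψ : Assign → Set) → Assign → Set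
  UntilBy R c Count Φ Ψ Π = ∃ λ k → Count k × ∃ λ (seq : ℕ → Assign) → (∀ x → seq 0 x ≡ Π x) ×
    (∀ j → j < k → StepBy R c (seq j) (seq (suc j))) × Ψ (seq k) × (∀ j → j < k → Φ (seq j))

  module _ {R : Trace → ℕ → ℕ → Set} where

    move-keeps-trace : ∀ {b m m' m₀} → MoveBy R b m m' → m ≡ setPos m₀ (posOf m) → m' ≡ setPos m₀ (posOf m')
    move-keeps-trace {true} {nothing} {m₀ = nothing} refl _ = refl
    move-keeps-trace {true} {just _} {m₀ = just _} (_ , _ , refl) refl = refl
    move-keeps-trace {false} refl m≡ = m≡

    move-active : ∀ {b m m' σ p} → b ≡ true → m ≡ just (σ , p) → MoveBy R b m m' → ∃ λ p' → R σ p p' × m' ≡ just (σ , p')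
    move-active refl refl move = move

    move-inactive : ∀ {b m m'} → b ≡ false → MoveBy R b m m' → m' ≡ m
    move-inactive refl move = move

    module _ {c : Ctx} {Π : Assign} {k : ℕ} {seq : ℕ → Assign} (start : ∀ x → seq 0 x ≡ Π x)
             (steps : ∀ j → j < k → StepBy R c (seq j) (seq (suc j))) where

      iterate-keeps-trace : ∀ y j → j ≤ k → seq j y ≡ setPos (Π y) (posOf (seq j y))
      iterate-keeps-trace y zero _ rewrite start y = sym (setPos-posOf (Π y))
      iterate-keeps-trace y (suc j) j<k = move-keeps-trace (steps j j<k y) (iterate-keeps-trace y j (<⇒≤ j<k))

      iterate-inactive : ∀ {y} → c y ≡ false → ∀ j → j ≤ k → seq j y ≡ Π y
      iterate-inactive {y} _ zero _ = start y
      iterate-inactive {y} cy (suc j) j<k = trans (move-inactive cy (steps j j<k y)) (iterate-inactive cy j (<⇒≤ j<k))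

      iterate-bound : ∀ {y σ i} → Π y ≡ just (σ , i) → ∀ j → j ≤ k → seq j y ≡ just (σ , posOf (seq j y))
      iterate-bound {y} Πy j j≤k = trans (iterate-keeps-trace y j j≤k) (cong (λ m → setPos m (posOf (seq j y))) Πy)

      iterate-moves : ∀ {y σ i} → c y ≡ true → Π y ≡ just (σ , i) → ∀ j → j < k →
                      R σ (posOf (seq j y)) (posOf (seq (suc j) y))
      iterate-moves {y} cy Πy j j<k
        with p' , r , seq' ← move-active cy (iterate-bound Πy j (<⇒≤ j<k)) (steps j j<k y) rewrite seq' = r

  atStep-sat : ∀ xs J φ e E → SatSOA e E (atStep xs J φ) ⇔
    (∀ e' → AgreeOutside (map posVar xs) e e' →
       (∀ {x} → x ∈ xs → E (stepVar x) (pair (e (tmpVar J)) (e' (posVar x))) ≡ true) → SatSOA e' E φ)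
  atStep-sat [] J φ e E = mk⇔
    (λ s e' agree _ → to (SatSOA-cong (λ m → sym (agree m (λ ()))) (λ _ → refl) φ) s)
    (λ h → h e (λ _ _ → refl) (λ ()))
  atStep-sat (x ∷ xs) J φ e E = mk⇔ to' from'
    where
      tJ = tmpVar J
      e₁ = λ a → upd e (posVar x) a
      e₁-tJ : ∀ a → e₁ a tJ ≡ e tJ
      e₁-tJ a = upd-other e a (λ eq → posVar≢tmpVar {x} {J} (sym eq))
      chosen = pairIn tJ (posVar x) (stepVar x)

      InStep : (ℕ → ℕ) → (ℕ → ℕ) → List Var → Set
      InStep e e' xs = ∀ {y} → y ∈ xs → E (stepVar y) (pair (e tJ) (e' (posVar y))) ≡ true

      to' : SatSOA e E (atStep (x ∷ xs) J φ) →
            ∀ e' → AgreeOutside (map posVar (x ∷ xs)) e e' → InStep e e' (x ∷ xs) → SatSOA e' E φ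
      to' h e' agree inStep =
        to (atStep-sat xs J φ (e₁ a) E) (to (sat-⇒ₐ (e₁ a) E chosen (atStep xs J φ)) (h a) inStep₀)
          e' (agreeOutside-upd e e' agree)
          (λ {y} y∈ → subst (λ u → E (stepVar y) (pair u (e' (posVar y))) ≡ true) (sym (e₁-tJ a)) (inStep (there y∈)))
        where
          a = e' (posVar x)
          inStep₀ : E (stepVar x) (pair (e₁ a tJ) (e₁ a (posVar x))) ≡ true
          inStep₀ rewrite e₁-tJ a | upd-same e (posVar x) a = inStep (here refl)

      from' : (∀ e' → AgreeOutside (map posVar (x ∷ xs)) e e' → InStep e e' (x ∷ xs) → SatSOA e' E φ) →
              SatSOA e E (atStep (x ∷ xs) J φ)
      from' H a = from (sat-⇒ₐ (e₁ a) E chosen (atStep xs J φ)) λ inStep₀ →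
        from (atStep-sat xs J φ (e₁ a) E) λ e' agree inStep → H e' (agreeOutside-∷ e a agree) (inStep' inStep₀ e' agree inStep)
        where
          inStep' : E (stepVar x) (pair (e₁ a tJ) (e₁ a (posVar x))) ≡ true →
                    ∀ e' → AgreeOutside (map posVar xs) (e₁ a) e' → InStep (e₁ a) e' xs → InStep e e' (x ∷ xs)
          inStep' _ e' _ inStep {y} (there y∈) = subst (λ u → E (stepVar y) (pair u (e' (posVar y))) ≡ true) (e₁-tJ a) (inStep y∈)
          inStep' inStep₀ e' agree inStep (here refl) with x ∈? xs
          ... | yes x∈ = subst (λ u → E (stepVar x) (pair u (e' (posVar x))) ≡ true) (e₁-tJ a) (inStep x∈)
          ... | no x∉ = subst₂ (λ u w → E (stepVar x) (pair u w) ≡ true) (e₁-tJ a)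
                          (sym (agree (posVar x) (∉-map-injective posVar-injective x∉))) inStep₀

  module _ (x : Var) (e : ℕ → ℕ) (E : ℕ → Subset) {k : ℕ} (ek : e (tmpVar 0) ≡ k) where
    private
      S = E (stepVar x)
      t₀ = tmpVar 0
      t₁ = tmpVar 1
      t₂ = tmpVar 2

    startsAtPos-sat : SatSOA e E (startsAtPos x) ⇔ (S (pair 0 (e (posVar x))) ≡ true)
    startsAtPos-sat = mk⇔
      (λ h → subst (λ u → S (pair 0 u) ≡ true) (pos-unchanged 0)
               (to (sat-⇒ₐ (e₁ 0) E (isZero t₁) (pairIn t₁ (posVar x) (stepVar x))) (h 0) (from (sat-isZero (e₁ 0) E t₁ refl) refl)))
      (λ inS a → from (sat-⇒ₐ (e₁ a) E (isZero t₁) (pairIn t₁ (posVar x) (stepVar x))) λ z →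
         subst₂ (λ j u → S (pair j u) ≡ true) (sym (to (sat-isZero (e₁ a) E t₁ refl) z)) (sym (pos-unchanged a)) inS)
      where
        e₁ = λ a → upd e t₁ a
        pos-unchanged : ∀ a → e₁ a (posVar x) ≡ e (posVar x)
        pos-unchanged a = upd-other e a (posVar≢tmpVar {x} {1})

    definedUpTo-sat : SatSOA e E (definedUpTo x) ⇔ (∀ j → j ≤ k → ∃ λ a → S (pair j a) ≡ true)
    definedUpTo-sat = Π-cong-⇔ λ j → sat-⇒ₐ-cong (upd e t₁ j) E (t₁ ≤ᵥ t₀) (∃₁ t₂ (pairIn t₁ t₂ (stepVar x)))
      (sat-≤ᵥ (upd e t₁ j) E t₁ t₀ refl ek) ⇔-refl

    movesBy-sat : ∀ {R : Trace → ℕ → ℕ → Set} {σ} (move : Var → SOA) →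
                  (∀ e' {a b} → e' (tmpVar 3) ≡ a → e' (tmpVar 4) ≡ b → SatSOA e' E (move x) ⇔ R σ a b) →
                  SatSOA e E (movesBy move x) ⇔
                  (∀ j a a' → j < k → S (pair j a) ≡ true → S (pair (suc j) a') ≡ true → R σ a a')
    movesBy-sat {R} {σ} move move-sat = mk⇔
      (λ h j a a' j<k inS inS' → to (sat-step j (suc j) a a') (h j (suc j) a a') (j<k , refl , inS , inS'))
      (λ h j j' a a' → from (sat-step j j' a a') λ (j<k , j'≡ , inS , inS') →
         h j a a' j<k inS (subst (λ i → S (pair i a') ≡ true) j'≡ inS'))
      where
        t₃ = tmpVar 3
        t₄ = tmpVar 4
        t₅ = tmpVar 5
        e₅ = λ j j' a a' → upd (upd (upd (upd e t₁ j) t₂ j') t₃ a) t₄ a'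
        inS₁ = pairIn t₁ t₃ (stepVar x)
        inS₂ = pairIn t₂ t₄ (stepVar x)
        cond = t₁ <ᵥ t₀ ∧ₐ isSuc t₁ t₂ t₅ ∧ₐ inS₁ ∧ₐ inS₂

        sat-cond : ∀ j j' a a' → SatSOA (e₅ j j' a a') E cond ⇔
                   (j < k × j' ≡ suc j × S (pair j a) ≡ true × S (pair j' a') ≡ true)
        sat-cond j j' a a' =
          sat-∧ₐ-cong e' E (t₁ <ᵥ t₀) (isSuc t₁ t₂ t₅ ∧ₐ inS₁ ∧ₐ inS₂) (sat-<ᵥ e' E t₁ t₀ refl ek)
            (sat-∧ₐ-cong e' E (isSuc t₁ t₂ t₅) (inS₁ ∧ₐ inS₂) (sat-isSuc e' E t₁ t₂ t₅ (λ ()) (λ ()) refl refl)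
              (sat-∧ₐ e' E inS₁ inS₂))
          where
            e' = e₅ j j' a a'

        sat-step : ∀ j j' a a' → SatSOA (e₅ j j' a a') E (cond ⇒ₐ move x) ⇔
                   ((j < k × j' ≡ suc j × S (pair j a) ≡ true × S (pair j' a') ≡ true) → R σ a a')
        sat-step j j' a a' = sat-⇒ₐ-cong (e₅ j j' a a') E cond (move x) (sat-cond j j' a a') (move-sat (e₅ j j' a a') refl refl)

  module Iteration
    {R : Trace → ℕ → ℕ → Set} (move : Var → SOA)
    (move-sat : ∀ {σ x E} → Represents σ (statesOf E x) →
                ∀ e {a b} → e (tmpVar 3) ≡ a → e (tmpVar 4) ≡ b → SatSOA e E (move x) ⇔ R σ a b)
    {Count : ℕ → Set} (count : SOA) (count-sat : ∀ e E → SatSOA e E count ⇔ Count (e (tmpVar 0)))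
    (bs : List Var) (c : Ctx)
    {Φ Ψ : Assign → Set} (φ ψ : SOA)
    (φ-sat : ∀ {Π e E} → Encodes bs Π e E → Φ Π ⇔ SatSOA e E φ)
    (ψ-sat : ∀ {Π e E} → Encodes bs Π e E → Ψ Π ⇔ SatSOA e E ψ)
    where

    private
      active = inContext c bs
      t₀ = tmpVar 0
      t₁ = tmpVar 1
      conditions = isIteration active move
      before = ∀₁ t₁ (t₁ <ᵥ t₀ ⇒ₐ atStep active 1 φ)
      body = conditions ∧ₐ atStep active 0 ψ ∧ₐ before

      active⇒bound : ∀ {x} → x ∈ active → x ∈ bs
      active⇒bound x∈ = proj₁ (∈-filter⁻ (λ x → c x ≟ᵇ true) {xs = bs} x∈)

      active⇒inContext : ∀ {x} → x ∈ active → c x ≡ true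
      active⇒inContext x∈ = proj₂ (∈-filter⁻ (λ x → c x ≟ᵇ true) {xs = bs} x∈)

      bound⇒active : ∀ {x} → x ∈ bs → c x ≡ true → x ∈ active
      bound⇒active x∈ cx = ∈-filter⁺ (λ x → c x ≟ᵇ true) x∈ cx

      posVar-after-tmp : ∀ (e : ℕ → ℕ) n a y → upd e (tmpVar n) a (posVar y) ≡ e (posVar y)
      posVar-after-tmp e n a y = upd-other e a (posVar≢tmpVar {y} {n})

      sat-body : ∀ e E → SatSOA e E body ⇔
                 (SatSOA e E conditions × SatSOA e E (atStep active 0 ψ) ×
                  (∀ j → j < e t₀ → SatSOA (upd e t₁ j) E (atStep active 1 φ)))
      sat-body e E =
        sat-∧ₐ-cong e E conditions (atStep active 0 ψ ∧ₐ before) ⇔-refl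
          (sat-∧ₐ-cong e E (atStep active 0 ψ) before ⇔-refl
            (Π-cong-⇔ λ j → sat-⇒ₐ-cong (upd e t₁ j) E (t₁ <ᵥ t₀) (atStep active 1 φ)
               (sat-<ᵥ (upd e t₁ j) E t₁ t₀ refl refl) ⇔-refl))

      sat-conditions : ∀ e E → SatSOA e E conditions ⇔
                       (∀ x → x ∈ active → SatSOA e E (startsAtPos x) × SatSOA e E (definedUpTo x) × SatSOA e E (movesBy move x))
      sat-conditions e E = ⇔-trans (sat-⋀ e E active _) (Π-cong-⇔ λ x → →-cong-⇔ ⇔-refl
        (sat-∧ₐ-cong e E (startsAtPos x) (definedUpTo x ∧ₐ movesBy move x) ⇔-refl (sat-∧ₐ e E (definedUpTo x) (movesBy move x))))

      sat-iterateUntil : ∀ e E → SatSOA e E (iterateUntil active move count ψ φ) ⇔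
                         (∃ λ k → Count k × ∃ λ E' → AgreeOutside (map stepVar active) E E' × SatSOA (upd e t₀ k) E' body)
      sat-iterateUntil e E = Σ-cong-⇔ λ k →
        sat-∧ₐ-cong (upd e t₀ k) E count (∃₂* (map stepVar active) body)
          (count-sat (upd e t₀ k) E) (sat-∃₂* (upd e t₀ k) E (map stepVar active) body)

      stateVars-agree : ∀ {E E' : ℕ → Subset} → AgreeOutside (map stepVar active) E E' →
                        ∀ y (v : Vertex) → E' (stateVar y v) ≡ E (stateVar y v)
      stateVars-agree agree y v = agree (stateVar y v) λ m∈ →
        let (x , _ , eq) = ∈-map⁻ stepVar m∈ in stateVar≢stepVar {x = y} {x} {v} eq

    module Forward {Π e E} (enc : Encodes bs Π e E) {k : ℕ} {seq : ℕ → Assign}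
                   (start : ∀ x → seq 0 x ≡ Π x) (steps : ∀ j → j < k → StepBy R c (seq j) (seq (suc j))) where
      open Encodes enc

      track : Var → Subset
      track y z = does (lem {∃ λ j → j ≤ k × z ≡ pair j (posOf (seq j y))})

      E' : ℕ → Subset
      E' = updMany E active stepVar track

      E'-stepVar : ∀ {x} → x ∈ active → E' (stepVar x) ≡ track x
      E'-stepVar = updMany-in E track stepVar-injective active

      track-intro : ∀ {x} j → x ∈ active → j ≤ k → E' (stepVar x) (pair j (posOf (seq j x))) ≡ true
      track-intro {x} j x∈ j≤k = trans (cong (λ S → S (pair j (posOf (seq j x)))) (E'-stepVar x∈)) (dec-true lem (j , j≤k , refl))

      track-elim : ∀ {x j a} → x ∈ active → E' (stepVar x) (pair j a) ≡ true → j ≤ k × a ≡ posOf (seq j x)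
      track-elim {x} {j} {a} x∈ inS
        with j' , j'≤k , eq ← does-true⇒ lem ( (trans (cong (λ S → S (pair j a)) (sym (E'-stepVar x∈))) inS))
        with refl , a≡ ← pair-injective j a j' _ eq = j'≤k , a≡

      unmoved : ∀ {y} → ¬ y ∈ active → ∀ j → j ≤ k → seq j y ≡ Π y
      unmoved {y} y∉ j j≤k with y ∈? bs
      ... | yes y∈bs = iterate-inactive start steps (¬-not (λ cy → y∉ (bound⇒active y∈bs cy))) j j≤k
      ... | no y∉bs = trans (iterate-keeps-trace start steps y j j≤k)
                            (trans (cong (λ m → setPos m (posOf (seq j y))) (unbound y∉bs)) (sym (unbound y∉bs)))

      encodes-at : ∀ {j e₀ e'} → j ≤ k → (∀ y → e₀ (posVar y) ≡ e (posVar y)) → AgreeOutside (map posVar active) e₀ e' →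
                   (∀ {x} → x ∈ active → E' (stepVar x) (pair j (e' (posVar x))) ≡ true) → Encodes bs (seq j) e' E'
      encodes-at {j} {e₀} {e'} j≤k e₀≗e agree inStep =
        encodes-moved active enc (stateVars-agree (updMany-agree E track active))
          (λ {y} y∈ → trans (iterate-keeps-trace start steps y j j≤k) (cong (setPos (Π y)) (sym (proj₂ (track-elim y∈ (inStep y∈))))))
          (λ {y} y∉ → unmoved y∉ j j≤k , trans (agree (posVar y) (∉-map-injective posVar-injective y∉)) (e₀≗e y))

      conditions-hold : SatSOA (upd e t₀ k) E' conditions
      conditions-hold = from (sat-conditions e₁ E') λ x x∈ →
        let (σ , Πx , rep) = bound (active⇒bound x∈)
            rep' = Represents-cong (λ v → sym (stateVars-agree (updMany-agree E track active) x v)) rep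
        in from (startsAtPos-sat x e₁ E' refl)
             (subst (λ u → E' (stepVar x) (pair 0 u) ≡ true)
                    (trans (cong posOf (trans (start x) Πx)) (sym (posVar-after-tmp e 0 k x))) (track-intro 0 x∈ z≤n)) ,
           from (definedUpTo-sat x e₁ E' refl) (λ j j≤k → posOf (seq j x) , track-intro j x∈ j≤k) ,
           from (movesBy-sat x e₁ E' refl {R = R} {σ} move (move-sat rep')) λ j a a' j<k inS inS' →
             subst₂ (R σ) (sym (proj₂ (track-elim x∈ inS))) (sym (proj₂ (track-elim x∈ inS')))
                    (iterate-moves start steps (active⇒inContext x∈) Πx j j<k)
        where
          e₁ = upd e t₀ k

      until⇒sat : Count k → Ψ (seq k) → (∀ j → j < k → Φ (seq j)) → SatSOA e E (iterateUntil active move count ψ φ)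
      until⇒sat cnt ψk φs = from (sat-iterateUntil e E)
        (k , cnt , E' , updMany-agree E track active , from (sat-body e₁ E') (conditions-hold , ψ-holds , φ-holds))
        where
          e₁ = upd e t₀ k

          ψ-holds : SatSOA e₁ E' (atStep active 0 ψ)
          ψ-holds = from (atStep-sat active 0 ψ e₁ E') λ e' agree inStep →
            to (ψ-sat (encodes-at ≤-refl (posVar-after-tmp e 0 k) agree inStep)) ψk

          φ-holds : ∀ j → j < k → SatSOA (upd e₁ t₁ j) E' (atStep active 1 φ)
          φ-holds j j<k = from (atStep-sat active 1 φ (upd e₁ t₁ j) E') λ e' agree inStep →
            to (φ-sat (encodes-at (<⇒≤ j<k) (λ y → trans (posVar-after-tmp e₁ 1 j y) (posVar-after-tmp e 0 k y)) agree inStep)) (φs j j<k)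

    module Backward {Π e E} (enc : Encodes bs Π e E) {k : ℕ} {E' : ℕ → Subset}
                    (agree : AgreeOutside (map stepVar active) E E') (holds : SatSOA (upd e t₀ k) E' body) where
      open Encodes enc
      private
        e₁ = upd e t₀ k
        parts = to (sat-body e₁ E') holds

        conditionsAt : ∀ {x} → x ∈ active →
                       SatSOA e₁ E' (startsAtPos x) × SatSOA e₁ E' (definedUpTo x) × SatSOA e₁ E' (movesBy move x)
        conditionsAt {x} x∈ = to (sat-conditions e₁ E') (proj₁ parts) x x∈

      starts : ∀ {x} → x ∈ active → E' (stepVar x) (pair 0 (e (posVar x))) ≡ true
      starts {x} x∈ = subst (λ u → E' (stepVar x) (pair 0 u) ≡ true) (posVar-after-tmp e 0 k x)
        (to (startsAtPos-sat x e₁ E' refl) (proj₁ (conditionsAt x∈)))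

      defined : ∀ {x} → x ∈ active → ∀ j → j ≤ k → ∃ λ a → E' (stepVar x) (pair j a) ≡ true
      defined {x} x∈ = to (definedUpTo-sat x e₁ E' refl) (proj₁ (proj₂ (conditionsAt x∈)))

      moves : ∀ {x σ i} → x ∈ active → Π x ≡ just (σ , i) → ∀ j a a' → j < k →
              E' (stepVar x) (pair j a) ≡ true → E' (stepVar x) (pair (suc j) a') ≡ true → R σ a a'
      moves {x} {σ} x∈ Πx with σ' , Πx' , rep ← bound (active⇒bound x∈) with refl ← trans (sym Πx) Πx' =
        to (movesBy-sat x e₁ E' refl {R = R} {σ} move (move-sat (Represents-cong (λ v → sym (stateVars-agree agree x v)) rep)))
           (proj₂ (proj₂ (conditionsAt x∈)))

      -- position of y after j moves, read off the guessed sets (junk 0 outside the iteration)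
      chosen : Var → ℕ → ℕ
      chosen y zero = e (posVar y)
      chosen y (suc j) with y ∈? active | suc j ≤? k
      ... | yes y∈ | yes j<k = proj₁ (defined y∈ (suc j) j<k)
      ... | _ | _ = 0

      chosen-in : ∀ {x} → x ∈ active → ∀ j → j ≤ k → E' (stepVar x) (pair j (chosen x j)) ≡ true
      chosen-in x∈ zero _ = starts x∈
      chosen-in {x} x∈ (suc j) j<k with x ∈? active | suc j ≤? k
      ... | yes x∈' | yes j<k' = proj₂ (defined x∈' (suc j) j<k')
      ... | no x∉ | _ = ⊥-elim (x∉ x∈)
      ... | yes _ | no j≮k = ⊥-elim (j≮k j<k)

      seq : ℕ → Assign
      seq j y with y ∈? active
      ... | yes _ = setPos (Π y) (chosen y j)
      ... | no _ = Π y

      seq-active : ∀ {y} → y ∈ active → ∀ j → seq j y ≡ setPos (Π y) (chosen y j)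
      seq-active {y} y∈ j with y ∈? active
      ... | yes _ = refl
      ... | no y∉ = ⊥-elim (y∉ y∈)

      seq-inactive : ∀ {y} → ¬ y ∈ active → ∀ j → seq j y ≡ Π y
      seq-inactive {y} y∉ j with y ∈? active
      ... | yes y∈ = ⊥-elim (y∉ y∈)
      ... | no _ = refl

      start : ∀ y → seq 0 y ≡ Π y
      start y = by-cases (y ∈? active)
        where
          by-cases : Dec (y ∈ active) → seq 0 y ≡ Π y
          by-cases (no y∉) = seq-inactive y∉ 0
          by-cases (yes y∈) with σ , Πy , _ ← bound (active⇒bound y∈) =
            trans (seq-active y∈ 0) (trans (cong (λ m → setPos m (e (posVar y))) Πy) (sym Πy))

      steps : ∀ j → j < k → StepBy R c (seq j) (seq (suc j))
      steps j j<k y = by-cases (y ∈? active)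
        where
          stays : ¬ y ∈ active → ∀ b → c y ≡ b → MoveBy R b (Π y) (Π y)
          stays _ false _ = refl
          stays y∉ true cy with y ∈? bs
          ... | yes y∈bs = ⊥-elim (y∉ (bound⇒active y∈bs cy))
          ... | no y∉bs rewrite unbound y∉bs = refl

          by-cases : Dec (y ∈ active) → MoveBy R (c y) (seq j y) (seq (suc j) y)
          by-cases (no y∉) rewrite seq-inactive y∉ j | seq-inactive y∉ (suc j) = stays y∉ (c y) refl
          by-cases (yes y∈) with σ , Πy , _ ← bound (active⇒bound y∈)
            rewrite seq-active y∈ j | seq-active y∈ (suc j) | Πy | active⇒inContext y∈ =
            chosen y (suc j) , moves y∈ Πy j _ _ j<k (chosen-in y∈ j (<⇒≤ j<k)) (chosen-in y∈ (suc j) j<k) , refl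

      envAt : (ℕ → ℕ) → ℕ → ℕ → ℕ
      envAt e₀ j = updMany e₀ active posVar (λ y → chosen y j)

      encodes-at : ∀ {j e₀} → (∀ y → e₀ (posVar y) ≡ e (posVar y)) → Encodes bs (seq j) (envAt e₀ j) E'
      encodes-at {j} {e₀} e₀≗e = encodes-moved active enc (stateVars-agree agree)
        (λ {y} y∈ → trans (seq-active y∈ j) (cong (setPos (Π y)) (sym (updMany-in e₀ (λ y → chosen y j) posVar-injective active y∈))))
        (λ {y} y∉ → seq-inactive y∉ j , trans (updMany-agree e₀ (λ y → chosen y j) active (posVar y) (∉-map-injective posVar-injective y∉)) (e₀≗e y))

      atStep-chosen : ∀ {J j e₀ χ} → e₀ (tmpVar J) ≡ j → j ≤ k → SatSOA e₀ E' (atStep active J χ) → SatSOA (envAt e₀ j) E' χ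
      atStep-chosen {J} {j} {e₀} {χ} e₀J j≤k s = to (atStep-sat active J χ e₀ E') s (envAt e₀ j) (updMany-agree e₀ _ active) λ {x} x∈ →
        subst₂ (λ u w → E' (stepVar x) (pair u w) ≡ true) (sym e₀J) (sym (updMany-in e₀ (λ y → chosen y j) posVar-injective active x∈))
               (chosen-in x∈ j j≤k)

      ψ-holds : Ψ (seq k)
      ψ-holds = from (ψ-sat (encodes-at (posVar-after-tmp e 0 k))) (atStep-chosen refl ≤-refl (proj₁ (proj₂ parts)))

      φ-holds : ∀ j → j < k → Φ (seq j)
      φ-holds j j<k = from (φ-sat (encodes-at λ y → trans (posVar-after-tmp e₁ 1 j y) (posVar-after-tmp e 0 k y)))
        (atStep-chosen refl (<⇒≤ j<k) (proj₂ (proj₂ parts) j j<k))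

    iterateUntil-sat : ∀ {Π e E} → Encodes bs Π e E →
                       UntilBy R c Count Φ Ψ Π ⇔ SatSOA e E (iterateUntil active move count ψ φ)
    iterateUntil-sat {e = e} {E} enc = mk⇔
      (λ (k , cnt , seq , start , steps , ψk , φs) → Forward.until⇒sat enc start steps cnt ψk φs)
      (λ s → let (k , cnt , E' , agree , holds) = to (sat-iterateUntil e E) s
                 open Backward enc agree holds
             in k , cnt , seq , start , steps , ψ-holds , φ-holds)

  moveSucc⇔moveBy : ∀ Γ b m m' → MoveSucc Γ b m m' ⇔ MoveBy (IsSucc Γ) b m m'
  moveSucc⇔moveBy Γ true nothing m' = ⇔-refl
  moveSucc⇔moveBy Γ true (just _) m' = ⇔-refl
  moveSucc⇔moveBy Γ false m m' = ⇔-refl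

  movePred⇔moveBy : ∀ Γ b m m' → MovePred Γ b m m' ⇔ MoveBy (IsPred Γ) b m m'
  movePred⇔moveBy Γ true nothing m' = ⇔-refl
  movePred⇔moveBy Γ true (just _) m' = ⇔-refl
  movePred⇔moveBy Γ false m m' = ⇔-refl

  module _ {Step : Assign → Assign → Set} {R : Trace → ℕ → ℕ → Set} {c : Ctx}
           (step⇔ : ∀ Π Π' → Step Π Π' ⇔ StepBy R c Π Π') {Ψ : Assign → Set} {Π : Assign} where

    until⇔untilBy : ∀ {Φ : Assign → Set} → (∃ λ k → ∃ λ (seq : ℕ → Assign) → (∀ x → seq 0 x ≡ Π x) ×
                       (∀ j → j < k → Step (seq j) (seq (suc j))) × Ψ (seq k) × (∀ j → j < k → Φ (seq j)))
                    ⇔ UntilBy R c (λ _ → ⊤) Φ Ψ Π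
    until⇔untilBy = mk⇔
      (λ (k , seq , start , steps , ψk , φs) → k , tt , seq , start , (λ j j<k → to (step⇔ _ _) (steps j j<k)) , ψk , φs)
      (λ (k , _ , seq , start , steps , ψk , φs) → k , seq , start , (λ j j<k → from (step⇔ _ _) (steps j j<k)) , ψk , φs)

    next⇔untilBy : (∃ λ Π' → Step Π Π' × Ψ Π') ⇔ UntilBy R c (_≡ 1) (λ _ → ⊤) Ψ Π
    next⇔untilBy = mk⇔
      (λ (Π' , st , ψ') → 1 , refl , twoStep Π' , (λ _ → refl) , (λ { zero _ → to (step⇔ Π Π') st ; (suc _) (s≤s ()) }) , ψ' , (λ _ _ → tt))
      (λ { (_ , refl , seq , start , steps , ψ₁ , _) →
           seq 1 , from (step⇔ Π (seq 1)) (λ x → subst (λ m → MoveBy R (c x) m (seq 1 x)) (start x) (steps 0 (s≤s z≤n) x)) , ψ₁ })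
      where
        twoStep : Assign → ℕ → Assign
        twoStep Π' zero = Π
        twoStep Π' (suc _) = Π'

  ⊤ₐ-sat : ∀ e E → SatSOA e E ⊤ₐ ⇔ ⊤
  ⊤ₐ-sat e E = mk⇔ (λ _ → tt) (λ _ → sat-⊤ₐ e E)

  countIsOne-sat : ∀ e E → SatSOA e E countIsOne ⇔ (e (tmpVar 0) ≡ 1)
  countIsOne-sat e E = ⇔-trans
    (Σ-cong-⇔ λ a → sat-∧ₐ-cong (upd e t₁ a) E (isZero t₁) (isSuc t₁ t₀ t₂)
      (sat-isZero (upd e t₁ a) E t₁ refl) (sat-isSuc (upd e t₁ a) E t₁ t₀ t₂ (λ ()) (λ ()) refl refl))
    (mk⇔ (λ { (_ , refl , eq) → eq }) (λ eq → 0 , refl , eq))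
    where
      t₀ = tmpVar 0
      t₁ = tmpVar 1
      t₂ = tmpVar 2

  encodes-[] : ∀ e E → Encodes [] emptyAssign e E
  encodes-[] e E = record { bound = λ () ; unbound = λ _ → refl }

  encodes-bind : ∀ {bs Π e E E' x σ a} → Encodes bs Π e E → AgreeOutside (stateVars x) E E' →
                 Represents σ (statesOf E' x) → a ≡ 0 → Encodes (x ∷ bs) (Π [ x ↦ (σ , 0) ]) (upd e (posVar x) a) E'
  encodes-bind {bs} {Π} {e} {E} {E'} {x} {σ} {a} enc agree rep a≡0 = record { bound = bound' ; unbound = unbound' }
    where
      open Encodes enc
      bound' : ∀ {y} → y ∈ x ∷ bs → ∃ λ σ' → (Π [ x ↦ (σ , 0) ]) y ≡ just (σ' , upd e (posVar x) a (posVar y)) × Represents σ' (statesOf E' y)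
      bound' {y} y∈ with y ≟ x
      ... | yes refl =
        σ , trans (upd-same Π y (just (σ , 0))) (cong (λ u → just (σ , u)) (sym (trans (upd-same e (posVar y) a) a≡0))) , rep
      ... | no y≢x with y∈
      ...   | here y≡x = ⊥-elim (y≢x y≡x)
      ...   | there y∈bs with σ' , Πy , rep' ← bound y∈bs =
        σ' , trans (upd-other Π (just (σ , 0)) y≢x)
                   (trans Πy (cong (λ u → just (σ' , u)) (sym (upd-other e a (λ eq → y≢x (posVar-injective eq)))))) ,
        Represents-cong (λ v → sym (agree (stateVar y v) (other-states v))) rep'
        where
          other-states : ∀ v → ¬ stateVar y v ∈ stateVars x
          other-states v m∈ with w , _ , eq ← ∈-map⁻ (stateVar x) m∈ = y≢x (proj₁ (stateVar-injective {x = y} {x} {v} {w} eq))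

      unbound' : ∀ {y} → ¬ y ∈ x ∷ bs → (Π [ x ↦ (σ , 0) ]) y ≡ nothing
      unbound' {y} y∉ = trans (upd-other Π (just (σ , 0)) (λ y≡x → y∉ (here y≡x))) (unbound (λ y∈ → y∉ (there y∈)))

  runStates : (ℕ → Subset) → Var → (ℕ → Vertex) → ℕ → Subset
  runStates E x ρ = updMany E vertices (stateVar x) (visitSets ρ)

  runStates-visits : ∀ E x ρ → Visits ρ (statesOf (runStates E x ρ) x)
  runStates-visits E x ρ = Visits-cong
    (λ v → sym (updMany-in E (visitSets ρ) (λ eq → proj₂ (stateVar-injective {x = x} {x} eq)) vertices (∈-allFin v)))
    (visitSets-visits ρ)

  module _ {bs : List Var} {x : Var} {Φ : Assign → Set} {F : SOA}
           (F-sat : ∀ {Π e E} → Encodes (x ∷ bs) Π e E → Φ Π ⇔ SatSOA e E F) where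
    private
      sat-bind∧ : ∀ e E a → SatSOA (upd e (posVar x) a) E (isZero (posVar x) ∧ₐ encodesRun x ∧ₐ F) ⇔
                            (a ≡ 0 × IsRunSets (statesOf E x) × SatSOA (upd e (posVar x) a) E F)
      sat-bind∧ e E a = sat-∧ₐ-cong e' E (isZero (posVar x)) (encodesRun x ∧ₐ F)
        (sat-isZero e' E (posVar x) (upd-same e (posVar x) a)) (sat-∧ₐ-cong e' E (encodesRun x) F (encodesRun-sat x e' E) ⇔-refl)
        where e' = upd e (posVar x) a

      sat-bind⇒ : ∀ e E a → SatSOA (upd e (posVar x) a) E (isZero (posVar x) ⇒ₐ encodesRun x ⇒ₐ F) ⇔
                            (a ≡ 0 → IsRunSets (statesOf E x) → SatSOA (upd e (posVar x) a) E F)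
      sat-bind⇒ e E a = sat-⇒ₐ-cong e' E (isZero (posVar x)) (encodesRun x ⇒ₐ F)
        (sat-isZero e' E (posVar x) (upd-same e (posVar x) a)) (sat-⇒ₐ-cong e' E (encodesRun x) F (encodesRun-sat x e' E) ⇔-refl)
        where e' = upd e (posVar x) a

      run-representation : ∀ {σ E} → Tr T σ →
                           ∃ λ E' → AgreeOutside (stateVars x) E E' × IsRunSets (statesOf E' x) × Represents σ (statesOf E' x)
      run-representation {E = E} (ρ , isRun , labels) =
        runStates E x ρ , updMany-agree E (visitSets ρ) vertices ,
        run⇒isRunSets isRun (runStates-visits E x ρ) , mkRepresents ρ labels (runStates-visits E x ρ)

      represented-run : ∀ {E'} → IsRunSets (statesOf E' x) → ∃ λ σ → Tr T σ × Represents σ (statesOf E' x)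
      represented-run sets with ρ , isRun , visits ← isRunSets⇒run sets =
        (λ i → label T (ρ i)) , (ρ , isRun , λ _ → refl) , mkRepresents ρ (λ _ → refl) visits

    exists-sat : ∀ {Π e E} → Encodes bs Π e E →
                 (∃ λ σ → Tr T σ × Φ (Π [ x ↦ (σ , 0) ])) ⇔
                 SatSOA e E (∃₂* (stateVars x) (∃₁ (posVar x) (isZero (posVar x) ∧ₐ encodesRun x ∧ₐ F)))
    exists-sat {Π} {e} {E} enc = ⇔-trans (mk⇔ to' from') (⇔-sym (sat-∃₂* e E (stateVars x) _))
      where
        to' : (∃ λ σ → Tr T σ × Φ (Π [ x ↦ (σ , 0) ])) → ∃ λ E' → AgreeOutside (stateVars x) E E' ×
              SatSOA e E' (∃₁ (posVar x) (isZero (posVar x) ∧ₐ encodesRun x ∧ₐ F))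
        to' (σ , tr , holds) with E' , agree , sets , rep ← run-representation tr =
          E' , agree , 0 , from (sat-bind∧ e E' 0) (refl , sets , to (F-sat (encodes-bind {E' = E'} enc agree rep refl)) holds)

        from' : (∃ λ E' → AgreeOutside (stateVars x) E E' × SatSOA e E' (∃₁ (posVar x) (isZero (posVar x) ∧ₐ encodesRun x ∧ₐ F))) →
                ∃ λ σ → Tr T σ × Φ (Π [ x ↦ (σ , 0) ])
        from' (E' , agree , a , s) with a≡0 , sets , holds ← to (sat-bind∧ e E' a) s
                                   with σ , tr , rep ← represented-run {E'} sets =
          σ , tr , from (F-sat (encodes-bind {E' = E'} enc agree rep a≡0)) holds

    forall-sat : ∀ {Π e E} → Encodes bs Π e E →
                 (∀ σ → Tr T σ → Φ (Π [ x ↦ (σ , 0) ])) ⇔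
                 SatSOA e E (∀₂* (stateVars x) (∀₁ (posVar x) (isZero (posVar x) ⇒ₐ encodesRun x ⇒ₐ F)))
    forall-sat {Π} {e} {E} enc = ⇔-trans (mk⇔ to' from') (⇔-sym (sat-∀₂* e E (stateVars x) _))
      where
        to' : (∀ σ → Tr T σ → Φ (Π [ x ↦ (σ , 0) ])) → ∀ E' → AgreeOutside (stateVars x) E E' →
              SatSOA e E' (∀₁ (posVar x) (isZero (posVar x) ⇒ₐ encodesRun x ⇒ₐ F))
        to' H E' agree a = from (sat-bind⇒ e E' a) λ a≡0 sets →
          let (σ , tr , rep) = represented-run {E'} sets in to (F-sat (encodes-bind {E' = E'} enc agree rep a≡0)) (H σ tr)

        from' : (∀ E' → AgreeOutside (stateVars x) E E' → SatSOA e E' (∀₁ (posVar x) (isZero (posVar x) ⇒ₐ encodesRun x ⇒ₐ F))) →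
                ∀ σ → Tr T σ → Φ (Π [ x ↦ (σ , 0) ])
        from' S σ tr with E' , agree , sets , rep ← run-representation tr =
          from (F-sat (encodes-bind {E' = E'} enc agree rep refl)) (to (sat-bind⇒ e E' 0) (S E' agree 0) refl sets)

  succStep⇔ : ∀ Γ c Π Π' → SuccStep Γ c Π Π' ⇔ StepBy (IsSucc Γ) c Π Π'
  succStep⇔ Γ c Π Π' = Π-cong-⇔ λ x → moveSucc⇔moveBy Γ (c x) (Π x) (Π' x)

  predStep⇔ : ∀ Γ c Π Π' → PredStep Γ c Π Π' ⇔ StepBy (IsPred Γ) c Π Π'
  predStep⇔ Γ c Π Π' = Π-cong-⇔ λ x → movePred⇔moveBy Γ (c x) (Π x) (Π' x)

  Holds : Ctx → GHy → Assign → Set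
  Holds c φ Π = Sat (Tr T) Π c φ

  encode-correct : ∀ φ {bs c Π e E} → Encodes bs Π e E → Sat (Tr T) Π c φ ⇔ SatSOA e E (encode bs c φ)
  encode-correct (ap p x) {bs} {e = e} {E} enc with x ∈? bs
  ... | yes x∈ with σ , Πx , rep ← Encodes.bound enc x∈ rewrite Πx = ⇔-sym (PLTLSemantics.hasLabel-sat {σ} {x} {E} rep e p (posVar x))
  ... | no x∉ rewrite Encodes.unbound enc x∉ = mk⇔ (λ ()) (sat-⊥ₐ e E)
  encode-correct (¬ₕ φ) enc = ¬-cong-⇔ (encode-correct φ enc)
  encode-correct (φ ∨ₕ ψ) enc = encode-correct φ enc ⊎-⇔ encode-correct ψ enc
  encode-correct (⟨ C ⟩ φ) enc = encode-correct φ enc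
  encode-correct (Xₕ Γ φ) {bs} {c} enc = ⇔-trans (next⇔untilBy (succStep⇔ Γ c) {Ψ = Holds c φ})
    (Iteration.iterateUntil-sat (succMove Γ) (λ {σ} {y} {E} rep → PLTLSemantics.succMove-sat {σ} {y} {E} rep Γ) countIsOne countIsOne-sat bs c
       {Ψ = Holds c φ} ⊤ₐ (encode bs c φ) (λ {_} {e} {E} _ → ⇔-sym (⊤ₐ-sat e E)) (encode-correct φ) enc)
  encode-correct (Uₕ Γ φ ψ) {bs} {c} enc = ⇔-trans (until⇔untilBy (succStep⇔ Γ c) {Holds c ψ} {Φ = Holds c φ})
    (Iteration.iterateUntil-sat (succMove Γ) (λ {σ} {y} {E} rep → PLTLSemantics.succMove-sat {σ} {y} {E} rep Γ) ⊤ₐ ⊤ₐ-sat bs c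
       {Holds c φ} {Holds c ψ} (encode bs c φ) (encode bs c ψ) (encode-correct φ) (encode-correct ψ) enc)
  encode-correct (Yₕ Γ φ) {bs} {c} enc = ⇔-trans (next⇔untilBy (predStep⇔ Γ c) {Ψ = Holds c φ})
    (Iteration.iterateUntil-sat (predMove Γ) (λ {σ} {y} {E} rep → PLTLSemantics.predMove-sat {σ} {y} {E} rep Γ) countIsOne countIsOne-sat bs c
       {Ψ = Holds c φ} ⊤ₐ (encode bs c φ) (λ {_} {e} {E} _ → ⇔-sym (⊤ₐ-sat e E)) (encode-correct φ) enc)
  encode-correct (Sₕ Γ φ ψ) {bs} {c} enc = ⇔-trans (until⇔untilBy (predStep⇔ Γ c) {Holds c ψ} {Φ = Holds c φ})
    (Iteration.iterateUntil-sat (predMove Γ) (λ {σ} {y} {E} rep → PLTLSemantics.predMove-sat {σ} {y} {E} rep Γ) ⊤ₐ ⊤ₐ-sat bs c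
       {Holds c φ} {Holds c ψ} (encode bs c φ) (encode bs c ψ) (encode-correct φ) (encode-correct ψ) enc)
  encode-correct (∃ₕ x φ) {bs} {c} enc = exists-sat (encode-correct φ {x ∷ bs} {c}) enc
  encode-correct (∀ₕ x φ) {bs} {c} enc = forall-sat (encode-correct φ {x ∷ bs} {c}) enc

mainTheorem6 : ReducibleToSOATruth
mainTheorem6 =
  reduction ,
  (λ (T , φ , _) → universalClosure-sentence (Translation.encode T [] allVars φ)) ,
  λ lem (T , φ , _) → let open Correctness T lem in
    universalClosure-sat (Translation.encode T [] allVars φ) (λ e E → encode-correct φ (encodes-[] e E))
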